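{- Let $x=X^{\tilde v\zeta}\tilde w\in W$ where $\zeta\in X$ is dominant and $\tilde v,\tilde w\in W_{\mathrm{aff}}$. Let $\tilde\alpha$ be an affine root and $j\in\mathbb{Z}$ with $\alpha=-\tilde v(\tilde\alpha)+j\pi$ a positive double affine root, and let $y=s_\alpha x$. Let $M$ be an integer with $\ell(\tilde w)\le M$ and $\ell(s_{\tilde v(\tilde\alpha)}\tilde w)\le M$, and suppose $\langle\zeta,\alpha_i\rangle\ge 2(M+1)$ for $i=0,1,\dots,n$. If $y$ is a cocover of $x$ in the Bruhat order, then $0\le j\le M$ or $\langle\zeta,\tilde\alpha\rangle-M\le j\le\langle\zeta,\tilde\alpha\rangle$.
   Context: Let $\Phi_{\mathrm{fin}}$ be an irreducible simply laced finite root system with simple roots $\alpha_1,\dots,\alpha_n$, highest root $\theta$, Weyl group $W_{\mathrm{fin}}$, root lattice $Q$, weight lattice $P$, and $W_{\mathrm{fin}}$-invariant pairing $\langle\,,\rangle$ with $\langle\nu,\nu\rangle=2$ for roots. Affine roots are $\nu+r\delta$ ($\nu\in\Phi_{\mathrm{fin}},r\in\mathbb{Z}$); $\nu+r\delta>0$ iff $r>0$, or $r=0$ and $\nu>0$. Affine simple roots: $\alpha_0=-\theta+\delta,\alpha_1,\dots,\alpha_n$. $X=P\oplus\mathbb{Z}\delta\oplus\mathbb{Z}\Lambda_0$, level of $\mu+m\delta+l\Lambda_0$ is $l$; $\langle \mu+m\delta+l\Lambda_0,\nu+r\delta\rangle=\langle\mu,\nu\rangle+lr$. $W_{\mathrm{aff}}=\{Y^\lambda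 w:\lambda\in Q,w\in W_{\mathrm{fin}}\}$ is the affine Weyl group with Coxeter length $\ell$ and $\mathrm{Inv}(\tilde w)=\{\beta>0:\tilde w(\beta)<0\}$, acting on $X$ by $Y^\lambda w(\mu+m\delta+l\Lambda_0)=w(\mu)+l\lambda+(m-\langle w(\mu),\lambda\rangle-l\langle\lambda,\lambda\rangle/2)\delta+l\Lambda_0$ and on affine roots by $Y^\lambda w(\nu+r\delta)=w(\nu)+(r-\langle\lambda,w(\nu)\rangle)\delta$; $s_{\nu+r\delta}=Y^{ -r\nu}s_\nu$. $\zeta$ dominant means $\langle\zeta,\alpha_i\rangle\ge0$ for $i=0,\dots,n$. Tits cone $\mathcal T=\{m\delta\}\cup\{\text{positive level elements}\}$; $W=\{X^\zeta\tilde w:\zeta\in\mathcal T,\tilde w\in W_{\mathrm{aff}}\}\subset X\rtimes W_{\mathrm{aff}}$ (with $\tilde wX^\zeta=X^{\tilde w\zeta}\tilde w$). Double affine roots $\tilde\alpha+j\pi$; positive if $\tilde\alpha>0,j\ge0$ or $\tilde\alpha<0,j>0$, negative otherwise. $s_{\tilde\alpha+j\pi}=X^{ -j\tilde\alpha}s_{\tilde\alpha}$, and $X^\zeta\tilde w(\tilde\alpha+j\pi)=\tilde w(\tilde\alpha)+(j-\langle\zeta,\tilde w(\tilde\alpha)\rangle)\pi$. Fix a linear functional $\langle\cdot,\rho\rangle$ on $X$ with $\langle\alpha_i,\rho\rangle=1$ for $i=0,\dots,n$. Length on $W$: $\ell(X^\zeta\tilde w)=\langle\zeta_+,2\rho\rangle+|\{\beta\in\mathrm{Inv}(\tilde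 w^{ -1}):\langle\zeta,\beta\rangle\le0\}|-|\{\beta\in\mathrm{Inv}(\tilde w^{ -1}):\langle\zeta,\beta\rangle>0\}|$, $\zeta_+$ the dominant element of the $W_{\mathrm{aff}}$-orbit of $\zeta$. The Bruhat order on $\{x\in W:\mathrm{lev}(x)>0\}$ is generated by $s_\alpha x<x$ for $\alpha$ positive with $x^{ -1}(\alpha)$ negative; $y$ is a cocover of $x$ if $y<x$ with no $z$ strictly between. -}

module Defs where

open import Data.Nat using (ℕ; zero; suc)
import Data.Nat as ℕ
open import Data.Integer using (ℤ; +_; _+_; _*_; -_; _-_; _≤_; _<_; _/ℕ_)
open import Data.Fin using (Fin; zero; suc)
open import Data.Vec using (Vec; []; _∷_; lookup; map; zipWith; replicate; _[_]≔_; foldr)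
open import Data.List using (List; length)
import Data.List as L
open import Data.Product using (Σ; ∃; _×_; _,_)
open import Data.Sum using (_⊎_)
open import Relation.Nullary using (¬_)
open import Relation.Binary.PropositionalEquality using (_≡_; _≢_)
open import Relation.Binary.Construct.Closure.Transitive using (TransClosure)

zeroV : ∀ {n} → Vec ℤ n
zeroV = replicate _ (+ 0)

_⊕_ : ∀ {n} → Vec ℤ n → Vec ℤ n → Vec ℤ n
_⊕_ = zipWith _+_

_·_ : ∀ {n} → ℤ → Vec ℤ n → Vec ℤ n
c · v = map (c *_) v

_⊖_ : ∀ {n} → Vec ℤ n → Vec ℤ n → Vec ℤ n
u ⊖ v = u ⊕ ((- + 1) · v)

dot : ∀ {n} → Vec ℤ n → Vec ℤ n → ℤ
dot u v = foldr _ _+_ (+ 0) (zipWith _*_ u v)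

-- Irreducible simply laced Cartan matrices of finite type
-- (A is stored as a vector of rows; A i j = ⟨α_i , α_j⟩)

entry : ∀ {n} → Vec (Vec ℤ n) n → Fin n → Fin n → ℤ
entry A i j = lookup (lookup A i) j

data Connected {n} (A : Vec (Vec ℤ n) n) : Fin n → Fin n → Set where
  here  : ∀ {i} → Connected A i i
  there : ∀ {i j k} → entry A i j ≡ - + 1 → Connected A j k → Connected A i k

record SimplyLacedCartan : Set where
  field
    n        : ℕ
    nonempty : 1 ℕ.≤ n
    A        : Vec (Vec ℤ n) n
    diag     : ∀ i → entry A i i ≡ + 2
    offdiag  : ∀ i j → i ≢ j → (entry A i j ≡ + 0) ⊎ (entry A i j ≡ - + 1)
    symm     : ∀ i j → entry A i j ≡ entry A j i
    irred    : ∀ i j → Connected A i j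
    -- finite type: the form v ↦ vᵀ A v is positive definite
    posdef   : ∀ (v : Vec ℤ n) → v ≢ zeroV → + 0 < dot v (map (λ row → dot row v) A)

module RootData (R : SimplyLacedCartan) where
  open SimplyLacedCartan R public

  -- Q : root lattice, coordinates w.r.t. simple roots α_1..α_n
  -- P : weight lattice, coordinates w.r.t. fundamental weights ω_1..ω_n
  Q P : Set
  Q = Vec ℤ n
  P = Vec ℤ n

  -- the inclusion Q ⊆ P  (α_j = Σ_i A_ij ω_i)
  ι : Q → P
  ι ν = map (λ row → dot row ν) A

  -- pairing P × Q → ℤ   (⟨ω_i , α_j⟩ = δ_ij)
  ⟪_,_⟫ : P → Q → ℤ
  ⟪ μ , ν ⟫ = dot μ ν

  ⟪_,_⟫Q : Q → Q → ℤ
  ⟪ λ' , ν ⟫Q = ⟪ ι λ' , ν ⟫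

  e : Fin n → Q
  e i = zeroV [ i ]≔ + 1

  record FinEl : Set where
    field
      onP    : P → P
      onQ    : Q → Q
      onQinv : Q → Q
  open FinEl public

  idF : FinEl
  idF = record { onP = λ μ → μ ; onQ = λ ν → ν ; onQinv = λ ν → ν }

  _∘F_ : FinEl → FinEl → FinEl
  f ∘F g = record { onP = λ μ → onP f (onP g μ)
                  ; onQ = λ ν → onQ f (onQ g ν)
                  ; onQinv = λ ν → onQinv g (onQinv f ν) }

  -- reflection in a (finite) root ν  (simply laced: ν^∨ = ν)
  reflF : Q → FinEl
  reflF ν = record { onP = λ μ → μ ⊖ (⟪ μ , ν ⟫ · ι ν)
                   ; onQ = λ λ' → λ' ⊖ (⟪ λ' , ν ⟫Q · ν)
                   ; onQinv = λ λ' → λ' ⊖ (⟪ λ' , ν ⟫Q · ν) }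

  wordF : List (Fin n) → FinEl
  wordF = L.foldr (λ i acc → reflF (e i) ∘F acc) idF

  IsFinW : FinEl → Set
  IsFinW f = Σ (List (Fin n)) λ ws →
      (∀ μ → onP f μ ≡ onP (wordF ws) μ)
    × (∀ ν → onQ f ν ≡ onQ (wordF ws) ν)
    × (∀ ν → onQinv f ν ≡ onQinv (wordF ws) ν)

  IsRoot : Q → Set
  IsRoot ν = Σ (List (Fin n)) λ ws → Σ (Fin n) λ i → ν ≡ onQ (wordF ws) (e i)

  -- ν > 0 for a root ν : all coordinates nonnegative
  NonNeg : Q → Set
  NonNeg ν = ∀ k → + 0 ≤ lookup ν k

  IsHighestRoot : Q → Set
  IsHighestRoot θ = IsRoot θ × (∀ β → IsRoot β → NonNeg (θ ⊖ β))

  -- X = P ⊕ ℤδ ⊕ ℤΛ₀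

  record X : Set where
    constructor mkX
    field
      fin : P
      dc  : ℤ   -- coefficient of δ
      lev : ℤ   -- level (coefficient of Λ₀)
  open X public

  _⊕X_ : X → X → X
  mkX μ m l ⊕X mkX μ' m' l' = mkX (μ ⊕ μ') (m + m') (l + l')

  _·X_ : ℤ → X → X
  c ·X mkX μ m l = mkX (c · μ) (c * m) (c * l)

  record AffRoot : Set where
    constructor _+δ_
    field
      rt : Q
      r  : ℤ
  open AffRoot public

  IsAffRoot : AffRoot → Set
  IsAffRoot α = IsRoot (rt α)

  negA : AffRoot → AffRoot
  negA (ν +δ k) = ((- + 1) · ν) +δ (- k)

  PosAff : AffRoot → Set
  PosAff (ν +δ k) = (+ 0 < k) ⊎ ((k ≡ + 0) × NonNeg ν)

  ιX : AffRoot → X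
  ιX (ν +δ k) = mkX (ι ν) k (+ 0)

  ⟪_,_⟫X : X → AffRoot → ℤ
  ⟪ mkX μ m l , ν +δ k ⟫X = ⟪ μ , ν ⟫ + l * k

  -- affine simple roots α_0 = -θ + δ, α_i (i = 1..n, indexed by suc)
  affSimple : Q → Fin (suc n) → AffRoot
  affSimple θ zero    = ((- + 1) · θ) +δ (+ 1)
  affSimple θ (suc i) = e i +δ (+ 0)

  Dominant : Q → X → Set
  Dominant θ ζ = ∀ i → + 0 ≤ ⟪ ζ , affSimple θ i ⟫X

  record Waff : Set where
    constructor Y_⋆_
    field
      tr  : Q
      lin : FinEl
  open Waff public

  IsWaff : Waff → Set
  IsWaff w = IsFinW (lin w)

  idA : Waff
  idA = Y zeroV ⋆ idF

  _∘A_ : Waff → Waff → Waff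
  (Y λ' ⋆ w) ∘A (Y λ'' ⋆ w') = Y (λ' ⊕ onQ w λ'') ⋆ (w ∘F w')

  sAff : AffRoot → Waff
  sAff (ν +δ k) = Y ((- k) · ν) ⋆ reflF ν

  actX : Waff → X → X
  actX (Y λ' ⋆ w) (mkX μ m l) =
    mkX (onP w μ ⊕ (l · ι λ'))
        (m - ⟪ onP w μ , λ' ⟫ - l * (⟪ λ' , λ' ⟫Q /ℕ 2))
        l

  actR : Waff → AffRoot → AffRoot
  actR (Y λ' ⋆ w) (ν +δ k) = onQ w ν +δ (k - ⟪ λ' , onQ w ν ⟫Q)

  invR : Waff → AffRoot → AffRoot
  invR (Y λ' ⋆ w) (μ +δ k) = onQinv w μ +δ (k + ⟪ λ' , μ ⟫Q)

  _≈A_ : Waff → Waff → Set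
  u ≈A v = (tr u ≡ tr v)
         × (∀ μ → onP (lin u) μ ≡ onP (lin v) μ)
         × (∀ ν → onQ (lin u) ν ≡ onQ (lin v) ν)
         × (∀ ν → onQinv (lin u) ν ≡ onQinv (lin v) ν)

  -- Coxeter length bound:  ℓ(w) ≤ M  (w is a product of ≤ M simple affine reflections)
  affWord : Q → List (Fin (suc n)) → Waff
  affWord θ = L.foldr (λ i acc → sAff (affSimple θ i) ∘A acc) idA

  LengthLE : Q → Waff → ℤ → Set
  LengthLE θ w M = Σ (List (Fin (suc n))) λ ws → (+ length ws ≤ M) × (affWord θ ws ≈A w)

  -- W = { X^ζ w̃ : ζ ∈ 𝒯 , w̃ ∈ W_aff }

  record Wel : Set where
    constructor X^_⋆_
    field
      wt  : X
      aff : Waff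
  open Wel public

  InTits : X → Set
  InTits ζ = ((fin ζ ≡ zeroV) × (lev ζ ≡ + 0)) ⊎ (+ 0 < lev ζ)

  IsW : Wel → Set
  IsW x = InTits (wt x) × IsWaff (aff x)

  levW : Wel → ℤ
  levW x = lev (wt x)

  _≈W_ : Wel → Wel → Set
  x ≈W y = (wt x ≡ wt y) × (aff x ≈A aff y)

  record DRoot : Set where
    constructor _+π_
    field
      dAff : AffRoot
      dj   : ℤ
  open DRoot public

  IsDRoot : DRoot → Set
  IsDRoot α = IsAffRoot (dAff α)

  DPos : DRoot → Set
  DPos (α +π j) = (PosAff α × (+ 0 ≤ j)) ⊎ ((¬ PosAff α) × (+ 0 < j))

  DNeg : DRoot → Set
  DNeg α = ¬ DPos α

  invW : Wel → DRoot → DRoot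
  invW (X^ ζ ⋆ w) (β +π k) = invR w β +π (k + ⟪ ζ , β ⟫X)

  -- s_{α̃ + jπ} · X^ζ w̃ = X^{-jα̃} s_α̃ X^ζ w̃ = X^{-jα̃ + s_α̃ ζ} s_α̃ w̃
  sD : DRoot → Wel → Wel
  sD (α +π j) (X^ ζ ⋆ w) = X^ (((- j) ·X ιX α) ⊕X actX (sAff α) ζ) ⋆ (sAff α ∘A w)

  -- generating relation of the Bruhat order on positive level elements:
  -- s_α x < x for α positive with x⁻¹(α) negative
  BStep : Wel → Wel → Set
  BStep y x = IsW x × (+ 0 < levW x) ×
    Σ DRoot (λ α → IsDRoot α × DPos α × DNeg (invW x α) × (y ≈W sD α x))

  _<B_ : Wel → Wel → Set
  y <B x = TransClosure BStep y x

  Cocover : Wel → Wel → Set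
  Cocover y x = (y <B x) × ¬ (Σ Wel λ z → (y <B z) × (z <B x))

{-# OPTIONS --safe #-}
module Submission where

-- Put γ = −ṽ(α̃), c = ⟨ζ, α̃⟩ and x = X^{ṽζ} w̃, so that y = s_{γ+jπ} x and
-- x⁻¹(γ + aπ) = w̃⁻¹(γ) + (a − c)π.  The reflections s_{γ+aπ} generate an infinite dihedral
-- group, with s_{γ+a₃π} s_{γ+a₂π} s_{γ+a₁π} = s_{γ+(a₁−a₂+a₃)π}.  Since w̃⁻¹(γ) and w̃⁻¹(−γ) are
-- not both positive, one of the choices (a₁, a₂, a₃) = (c, c−1, j−1) or (c−1, c−2, j−1) makes
-- y < z₂ < z₁ < x a chain of Bruhat steps whenever 2 ≤ j ≤ c − 2, so a cocover has j ≤ 1 or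
-- j ≥ c − 1.  If j > c, then s_{γ+jπ} and s_{−γ−jπ} are the only reflections taking x to y (a
-- reflection determines its root up to sign), and neither is a Bruhat step below x.  Finally
-- M ≥ 1, because w̃ and s_{ṽα̃} w̃ cannot both be the identity.

open import Defs
open import Data.Integer using (ℤ; +_; _+_; _*_; -_; _-_; _≤_)
open import Data.Fin using (Fin)
open import Data.Nat using (suc)
open import Data.Product using (_×_)
open import Data.Sum using (_⊎_)

open import Data.Nat as ℕ using (ℕ; zero)
import Data.Nat.Properties as ℕ
open import Data.Nat.DivMod using (m*n%n≡0; m*n/n≡m)
open import Data.Fin using (zero; suc)
import Data.Fin.Properties as Fin
open import Data.Integer using (-[1+_]; -1ℤ; _/ℕ_; NonZero; ∣_∣; _<_; _≤?_; _<?_; +≤+; +<+)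
import Data.Integer.Properties as ℤ
open import Algebra.Properties.AbelianGroup ℤ.+-0-abelianGroup using (∙-cancelʳ)
open import Data.Integer.Tactic.RingSolver using (solve-∀)
open import Data.Vec using (Vec; []; _∷_; lookup; map; _[_]≔_)
import Data.Vec.Properties as V
open import Data.List using (List; []; _∷_; _++_; reverse)
import Data.List.Properties as List
open import Data.Product using (Σ; _,_; proj₁; proj₂)
open import Data.Sum using (inj₁; inj₂)
open import Data.Empty using (⊥-elim)
open import Relation.Nullary using (¬_; Dec; yes; no; contradiction)
open import Relation.Binary.PropositionalEquality using (_≡_; refl; sym; trans; cong; cong₂; subst; module ≡-Reasoning)
open import Relation.Binary.Construct.Closure.Transitive using (TransClosure; [_]; _∷_)

private variable m : ℕ

Vec-ext : {u v : Vec ℤ m} → (∀ i → lookup u i ≡ lookup v i) → u ≡ v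
Vec-ext {u = u} {v} h = trans (sym (V.tabulate∘lookup u)) (trans (V.tabulate-cong h) (V.tabulate∘lookup v))

lookup-⊕ : (u v : Vec ℤ m) (i : Fin m) → lookup (u ⊕ v) i ≡ lookup u i + lookup v i
lookup-⊕ u v i = V.lookup-zipWith _+_ i u v

lookup-· : (c : ℤ) (u : Vec ℤ m) (i : Fin m) → lookup (c · u) i ≡ c * lookup u i
lookup-· c u i = V.lookup-map i (c *_) u

lookup-zeroV : (i : Fin m) → lookup (zeroV {m}) i ≡ + 0
lookup-zeroV i = V.lookup-replicate i (+ 0)

⊕-zeroʳ : (u : Vec ℤ m) → u ⊕ zeroV ≡ u
⊕-zeroʳ [] = refl
⊕-zeroʳ (x ∷ u) = cong₂ _∷_ (ℤ.+-identityʳ x) (⊕-zeroʳ u)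

⊕-cancelʳ : (u v w : Vec ℤ m) → u ⊕ w ≡ v ⊕ w → u ≡ v
⊕-cancelʳ [] [] [] _ = refl
⊕-cancelʳ (x ∷ u) (y ∷ v) (z ∷ w) eq =
  cong₂ _∷_ (∙-cancelʳ z x y (V.∷-injectiveˡ eq)) (⊕-cancelʳ u v w (V.∷-injectiveʳ eq))

·-distribˡ-⊕ : (c : ℤ) (u v : Vec ℤ m) → c · (u ⊕ v) ≡ (c · u) ⊕ (c · v)
·-distribˡ-⊕ c [] [] = refl
·-distribˡ-⊕ c (x ∷ u) (y ∷ v) = cong₂ _∷_ (ℤ.*-distribˡ-+ c x y) (·-distribˡ-⊕ c u v)

·-assoc : (c d : ℤ) (u : Vec ℤ m) → c · (d · u) ≡ (c * d) · u
·-assoc c d [] = refl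
·-assoc c d (x ∷ u) = cong₂ _∷_ (sym (ℤ.*-assoc c d x)) (·-assoc c d u)

·-identityˡ : (u : Vec ℤ m) → (+ 1) · u ≡ u
·-identityˡ [] = refl
·-identityˡ (x ∷ u) = cong₂ _∷_ (ℤ.*-identityˡ x) (·-identityˡ u)

·-zeroˡ : (u : Vec ℤ m) → (+ 0) · u ≡ zeroV
·-zeroˡ [] = refl
·-zeroˡ (x ∷ u) = cong (+ 0 ∷_) (·-zeroˡ u)

dot-comm : (u v : Vec ℤ m) → dot u v ≡ dot v u
dot-comm [] [] = refl
dot-comm (x ∷ u) (y ∷ v) = cong₂ _+_ (ℤ.*-comm x y) (dot-comm u v)

dot-zeroʳ : (u : Vec ℤ m) → dot u zeroV ≡ + 0
dot-zeroʳ [] = refl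
dot-zeroʳ (x ∷ u) = cong₂ _+_ (ℤ.*-zeroʳ x) (dot-zeroʳ u)

dot-⊕ˡ : (u v w : Vec ℤ m) → dot (u ⊕ v) w ≡ dot u w + dot v w
dot-⊕ˡ [] [] [] = refl
dot-⊕ˡ (x ∷ u) (y ∷ v) (z ∷ w) = trans (cong (_+_ ((x + y) * z)) (dot-⊕ˡ u v w)) (lemma x y z (dot u w) (dot v w))
  where lemma : ∀ x y z a b → (x + y) * z + (a + b) ≡ x * z + a + (y * z + b)
        lemma = solve-∀

dot-⊕ʳ : (u v w : Vec ℤ m) → dot u (v ⊕ w) ≡ dot u v + dot u w
dot-⊕ʳ u v w = begin
  dot u (v ⊕ w)         ≡⟨ dot-comm u (v ⊕ w) ⟩
  dot (v ⊕ w) u         ≡⟨ dot-⊕ˡ v w u ⟩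
  dot v u + dot w u     ≡⟨ cong₂ _+_ (dot-comm v u) (dot-comm w u) ⟩
  dot u v + dot u w     ∎
  where open ≡-Reasoning

dot-·ˡ : (c : ℤ) (u v : Vec ℤ m) → dot (c · u) v ≡ c * dot u v
dot-·ˡ c [] [] = sym (ℤ.*-zeroʳ c)
dot-·ˡ c (x ∷ u) (y ∷ v) = trans (cong (_+_ (c * x * y)) (dot-·ˡ c u v)) (lemma c x y (dot u v))
  where lemma : ∀ c x y a → c * x * y + c * a ≡ c * (x * y + a)
        lemma = solve-∀

dot-·ʳ : (c : ℤ) (u v : Vec ℤ m) → dot u (c · v) ≡ c * dot u v
dot-·ʳ c u v = trans (dot-comm u (c · v)) (trans (dot-·ˡ c v u) (cong (c *_) (dot-comm v u)))

dot-⊖ˡ : (u v w : Vec ℤ m) → dot (u ⊖ v) w ≡ dot u w - dot v w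
dot-⊖ˡ u v w = trans (dot-⊕ˡ u (-1ℤ · v) w)
  (cong (_+_ (dot u w)) (trans (dot-·ˡ -1ℤ v w) (ℤ.-1*i≡-i (dot v w))))

dot-⊖ʳ : (u v w : Vec ℤ m) → dot u (v ⊖ w) ≡ dot u v - dot u w
dot-⊖ʳ u v w = trans (dot-⊕ʳ u v (-1ℤ · w))
  (cong (_+_ (dot u v)) (trans (dot-·ʳ -1ℤ u w) (ℤ.-1*i≡-i (dot u w))))

dot-unitʳ : (u : Vec ℤ m) (i : Fin m) → dot u (zeroV [ i ]≔ + 1) ≡ lookup u i
dot-unitʳ (x ∷ u) zero = trans (cong₂ _+_ (ℤ.*-identityʳ x) (dot-zeroʳ u)) (ℤ.+-identityʳ x)
dot-unitʳ (x ∷ u) (suc i) = trans (cong₂ _+_ (ℤ.*-zeroʳ x) (dot-unitʳ u i)) (ℤ.+-identityˡ _)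

-- _/ℕ_ rounds towards -∞, so for negative i the exactness comes from the vanishing remainder.
[i*2]/ℕ2≡i : ∀ i → (i * + 2) /ℕ 2 ≡ i
[i*2]/ℕ2≡i (+ n) = trans (cong (_/ℕ 2) (ℤ.+◃n≡+n (n ℕ.* 2))) (cong +_ (m*n/n≡m n 2))
[i*2]/ℕ2≡i -[1+ n ] = trans (odd-free (ℕ.suc (n ℕ.* 2)) (m*n%n≡0 (ℕ.suc n) 2)) (cong (λ q → - (+ q)) (m*n/n≡m (ℕ.suc n) 2))
  where
    odd-free : ∀ k → ℕ.suc k ℕ.% 2 ≡ 0 → -[1+ k ] /ℕ 2 ≡ - (+ (ℕ.suc k ℕ./ 2))
    odd-free k eq with ℕ.suc k ℕ.% 2 | eq
    ... | zero | _ = refl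

⊖-·-additive : (a b w : Vec ℤ m) (x y : ℤ) → (a ⊕ b) ⊖ ((x + y) · w) ≡ (a ⊖ (x · w)) ⊕ (b ⊖ (y · w))
⊖-·-additive [] [] [] x y = refl
⊖-·-additive (a ∷ as) (b ∷ bs) (w ∷ ws) x y = cong₂ _∷_ (lemma a b w x y) (⊖-·-additive as bs ws x y)
  where lemma : ∀ a b w x y → (a + b) + - + 1 * ((x + y) * w) ≡ (a + - + 1 * (x * w)) + (b + - + 1 * (y * w))
        lemma = solve-∀

⊖-·-homogeneous : (c : ℤ) (a w : Vec ℤ m) (x : ℤ) → (c · a) ⊖ ((c * x) · w) ≡ c · (a ⊖ (x · w))
⊖-·-homogeneous c [] [] x = refl
⊖-·-homogeneous c (a ∷ as) (w ∷ ws) x = cong₂ _∷_ (lemma c a w x) (⊖-·-homogeneous c as ws x)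
  where lemma : ∀ c a w x → c * a + - + 1 * ((c * x) * w) ≡ c * (a + - + 1 * (x * w))
        lemma = solve-∀

⊖-·-cancel : (a w : Vec ℤ m) (x : ℤ) → (a ⊖ (x · w)) ⊖ ((- x) · w) ≡ a
⊖-·-cancel [] [] x = refl
⊖-·-cancel (a ∷ as) (w ∷ ws) x = cong₂ _∷_ (lemma a w x) (⊖-·-cancel as ws x)
  where lemma : ∀ a w x → (a + - + 1 * (x * w)) + - + 1 * ((- x) * w) ≡ a
        lemma = solve-∀

u⊖2u≡-u : (u : Vec ℤ m) → u ⊖ ((+ 2) · u) ≡ -1ℤ · u
u⊖2u≡-u [] = refl
u⊖2u≡-u (x ∷ u) = cong₂ _∷_ (lemma x) (u⊖2u≡-u u)
  where lemma : ∀ x → x + - + 1 * (+ 2 * x) ≡ - + 1 * x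
        lemma = solve-∀

·-cancelˡ : ∀ (c : ℤ) .{{_ : NonZero c}} (u v : Vec ℤ m) → c · u ≡ c · v → u ≡ v
·-cancelˡ c [] [] _ = refl
·-cancelˡ c (x ∷ u) (y ∷ v) eq =
  cong₂ _∷_ (ℤ.*-cancelˡ-≡ c x y (V.∷-injectiveˡ eq)) (·-cancelˡ c u v (V.∷-injectiveʳ eq))

-u≡u⊖v⇒v≡2u : (u v : Vec ℤ m) → -1ℤ · u ≡ u ⊖ v → v ≡ (+ 2) · u
-u≡u⊖v⇒v≡2u [] [] _ = refl
-u≡u⊖v⇒v≡2u (x ∷ u) (y ∷ v) eq = cong₂ _∷_ (pointwise x y (V.∷-injectiveˡ eq)) (-u≡u⊖v⇒v≡2u u v (V.∷-injectiveʳ eq))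
  where
    pointwise : ∀ x y → - + 1 * x ≡ x + - + 1 * y → y ≡ + 2 * x
    pointwise x y e = begin
      y                        ≡⟨ move-y x y ⟩
      x - (x + - + 1 * y)      ≡⟨ cong (_-_ x) (sym e) ⟩
      x - - + 1 * x            ≡⟨ double x ⟩
      + 2 * x                  ∎
      where
        open ≡-Reasoning
        move-y : ∀ x y → y ≡ x - (x + - + 1 * y)
        move-y = solve-∀
        double : ∀ x → x - - + 1 * x ≡ + 2 * x
        double = solve-∀

square≡4 : ∀ t → t * t ≡ + 4 → t ≡ + 2 ⊎ t ≡ - + 2
square≡4 t eq with ℕ-square≡4 ∣ t ∣ (trans (sym (ℤ.abs-* t t)) (cong ∣_∣ eq))
  where
    ℕ-square≡4 : ∀ m → m ℕ.* m ≡ 4 → m ≡ 2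
    ℕ-square≡4 0 ()
    ℕ-square≡4 1 ()
    ℕ-square≡4 2 _ = refl
    ℕ-square≡4 (suc (suc (suc m))) eq = contradiction (subst (9 ℕ.≤_) eq (ℕ.*-mono-≤ {3} {3 ℕ.+ m} {3} 3≤ 3≤)) 4≱9
      where
        3≤ : 3 ℕ.≤ 3 ℕ.+ m
        3≤ = ℕ.s≤s (ℕ.s≤s (ℕ.s≤s ℕ.z≤n))
        4≱9 : ¬ 9 ℕ.≤ 4
        4≱9 = ℕ.<⇒≱ (ℕ.s≤s (ℕ.s≤s (ℕ.s≤s (ℕ.s≤s (ℕ.s≤s ℕ.z≤n)))))
square≡4 (+ _) eq | refl = inj₁ refl
square≡4 -[1+ 1 ] eq | refl = inj₂ refl

positive-by : ∀ {e} s → + 0 ≤ s → e ≡ s + + 1 → + 0 < e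
positive-by s 0≤s refl = ℤ.suc[i]≤j⇒i<j (subst (+ 1 ≤_) (ℤ.+-comm (+ 1) s) (ℤ.+-monoʳ-≤ (+ 1) 0≤s))

negative-by : ∀ {e} s → + 0 ≤ s → e ≡ - s - + 1 → e < + 0
negative-by s 0≤s refl = ℤ.suc[i]≤j⇒i<j (subst (_≤ + 0) (lemma s) (ℤ.neg-mono-≤ 0≤s))
  where lemma : ∀ s → - s ≡ + 1 + (- s - + 1)
        lemma = solve-∀

0≤+ : ∀ n → + 0 ≤ + n
0≤+ n = +≤+ ℕ.z≤n

unsplittable⇒step : ∀ {A : Set} {_∼_ : A → A → Set} {y x} → TransClosure _∼_ y x →
  ¬ (Σ A λ z → TransClosure _∼_ y z × TransClosure _∼_ z x) → y ∼ x
unsplittable⇒step [ y∼x ] _ = y∼x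
unsplittable⇒step (y∼z ∷ z⁺x) no-split = ⊥-elim (no-split (_ , [ y∼z ] , z⁺x))

module RootDatum (R : SimplyLacedCartan) where
  open RootData R

  private
    rowsDot-⊕ : ∀ {k m} (M : Vec (Vec ℤ k) m) (u v : Vec ℤ k) →
      map (λ r → dot r (u ⊕ v)) M ≡ map (λ r → dot r u) M ⊕ map (λ r → dot r v) M
    rowsDot-⊕ [] u v = refl
    rowsDot-⊕ (r ∷ M) u v = cong₂ _∷_ (dot-⊕ʳ r u v) (rowsDot-⊕ M u v)

    rowsDot-· : ∀ {k m} (M : Vec (Vec ℤ k) m) (c : ℤ) (u : Vec ℤ k) →
      map (λ r → dot r (c · u)) M ≡ c · map (λ r → dot r u) M
    rowsDot-· [] c u = refl
    rowsDot-· (r ∷ M) c u = cong₂ _∷_ (dot-·ʳ c r u) (rowsDot-· M c u)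

    -- combineRows M v = Mᵀ v, so rowsDot-dot is the adjointness of M and Mᵀ.
    combineRows : ∀ {k m} → Vec (Vec ℤ k) m → Vec ℤ m → Vec ℤ k
    combineRows [] [] = zeroV
    combineRows (r ∷ M) (x ∷ v) = (x · r) ⊕ combineRows M v

    rowsDot-dot : ∀ {k m} (M : Vec (Vec ℤ k) m) (u : Vec ℤ k) (v : Vec ℤ m) →
      dot (map (λ r → dot r u) M) v ≡ dot u (combineRows M v)
    rowsDot-dot [] u [] = sym (dot-zeroʳ u)
    rowsDot-dot (r ∷ M) u (x ∷ v) = begin
      dot r u * x + dot (map (λ r → dot r u) M) v  ≡⟨ cong₂ _+_ (trans (ℤ.*-comm (dot r u) x) (cong (x *_) (dot-comm r u))) (rowsDot-dot M u v) ⟩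
      x * dot u r + dot u (combineRows M v)        ≡⟨ cong (_+ dot u (combineRows M v)) (sym (dot-·ʳ x u r)) ⟩
      dot u (x · r) + dot u (combineRows M v)      ≡⟨ sym (dot-⊕ʳ u (x · r) (combineRows M v)) ⟩
      dot u (combineRows (r ∷ M) (x ∷ v))          ∎
      where open ≡-Reasoning

    lookup-combineRows : ∀ {k m} (M : Vec (Vec ℤ k) m) (v : Vec ℤ m) (j : Fin k) →
      lookup (combineRows M v) j ≡ dot (map (λ r → lookup r j) M) v
    lookup-combineRows [] [] j = lookup-zeroV j
    lookup-combineRows (r ∷ M) (x ∷ v) j =
      trans (lookup-⊕ (x · r) (combineRows M v) j)
            (cong₂ _+_ (trans (lookup-· x r j) (ℤ.*-comm x (lookup r j))) (lookup-combineRows M v j))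

    column≡row : (j : Fin n) → map (λ r → lookup r j) A ≡ lookup A j
    column≡row j = Vec-ext λ i → trans (V.lookup-map i (λ r → lookup r j) A) (symm i j)

    combineRows-A : (v : Q) → combineRows A v ≡ ι v
    combineRows-A v = Vec-ext λ j → begin
      lookup (combineRows A v) j           ≡⟨ lookup-combineRows A v j ⟩
      dot (map (λ r → lookup r j) A) v     ≡⟨ cong (λ c → dot c v) (column≡row j) ⟩
      dot (lookup A j) v                   ≡⟨ sym (V.lookup-map j (λ row → dot row v) A) ⟩
      lookup (ι v) j                       ∎
      where open ≡-Reasoning

  ι-⊕ : (u v : Q) → ι (u ⊕ v) ≡ ι u ⊕ ι v
  ι-⊕ = rowsDot-⊕ A

  ι-· : (c : ℤ) (u : Q) → ι (c · u) ≡ c · ι u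
  ι-· = rowsDot-· A

  ι-⊖ : (u v : Q) → ι (u ⊖ v) ≡ ι u ⊖ ι v
  ι-⊖ u v = trans (ι-⊕ u (-1ℤ · v)) (cong (ι u ⊕_) (ι-· -1ℤ v))

  ⟪⟫Q-sym : (u v : Q) → ⟪ u , v ⟫Q ≡ ⟪ v , u ⟫Q
  ⟪⟫Q-sym u v = trans (rowsDot-dot A u v) (trans (cong (dot u) (combineRows-A v)) (dot-comm u (ι v)))

  Norm2 : Q → Set
  Norm2 ν = ⟪ ν , ν ⟫Q ≡ + 2

  e-norm2 : (i : Fin n) → Norm2 (e i)
  e-norm2 i = begin
    dot (ι (e i)) (e i)   ≡⟨ dot-unitʳ (ι (e i)) i ⟩
    lookup (ι (e i)) i    ≡⟨ V.lookup-map i (λ row → dot row (e i)) A ⟩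
    dot (lookup A i) (e i) ≡⟨ dot-unitʳ (lookup A i) i ⟩
    entry A i i           ≡⟨ diag i ⟩
    + 2                   ∎
    where open ≡-Reasoning

  record IsIsometry (f : FinEl) : Set where
    field
      onP-⊕   : ∀ a b → onP f (a ⊕ b) ≡ onP f a ⊕ onP f b
      onP-·   : ∀ c a → onP f (c · a) ≡ c · onP f a
      onQ-⊕   : ∀ a b → onQ f (a ⊕ b) ≡ onQ f a ⊕ onQ f b
      onQ-·   : ∀ c a → onQ f (c · a) ≡ c · onQ f a
      ι-onQ   : ∀ l → ι (onQ f l) ≡ onP f (ι l)
      pairing : ∀ μ l → ⟪ onP f μ , onQ f l ⟫ ≡ ⟪ μ , l ⟫

    onP-⊖ : ∀ a b → onP f (a ⊖ b) ≡ onP f a ⊖ onP f b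
    onP-⊖ a b = trans (onP-⊕ a (-1ℤ · b)) (cong (onP f a ⊕_) (onP-· -1ℤ b))

    onQ-⊖ : ∀ a b → onQ f (a ⊖ b) ≡ onQ f a ⊖ onQ f b
    onQ-⊖ a b = trans (onQ-⊕ a (-1ℤ · b)) (cong (onQ f a ⊕_) (onQ-· -1ℤ b))

    pairingQ : ∀ a b → ⟪ onQ f a , onQ f b ⟫Q ≡ ⟪ a , b ⟫Q
    pairingQ a b = trans (cong (λ t → dot t (onQ f b)) (ι-onQ a)) (pairing (ι a) b)
  open IsIsometry public

  module _ (ν : Q) (nν : Norm2 ν) where
    private
      coefficient-flip : ∀ s → s - s * + 2 ≡ - s
      coefficient-flip = solve-∀

      ⟪reflF⟫ : ∀ μ → ⟪ onP (reflF ν) μ , ν ⟫ ≡ - ⟪ μ , ν ⟫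
      ⟪reflF⟫ μ = trans (dot-⊖ˡ μ (dot μ ν · ι ν) ν)
        (trans (cong (_-_ (dot μ ν)) (trans (dot-·ˡ (dot μ ν) (ι ν) ν) (cong (dot μ ν *_) nν))) (coefficient-flip (dot μ ν)))

    reflF-isIsometry : IsIsometry (reflF ν)
    reflF-isIsometry = record
      { onP-⊕ = λ a b → trans (cong (λ t → (a ⊕ b) ⊖ (t · ι ν)) (dot-⊕ˡ a b ν)) (⊖-·-additive a b (ι ν) (dot a ν) (dot b ν))
      ; onP-· = λ c a → trans (cong (λ t → (c · a) ⊖ (t · ι ν)) (dot-·ˡ c a ν)) (⊖-·-homogeneous c a (ι ν) (dot a ν))
      ; onQ-⊕ = λ a b → trans (cong (λ t → (a ⊕ b) ⊖ (t · ν)) (trans (cong (λ t → dot t ν) (ι-⊕ a b)) (dot-⊕ˡ (ι a) (ι b) ν)))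
                              (⊖-·-additive a b ν (dot (ι a) ν) (dot (ι b) ν))
      ; onQ-· = λ c a → trans (cong (λ t → (c · a) ⊖ (t · ν)) (trans (cong (λ t → dot t ν) (ι-· c a)) (dot-·ˡ c (ι a) ν)))
                              (⊖-·-homogeneous c a ν (dot (ι a) ν))
      ; ι-onQ = λ l → trans (ι-⊖ l (dot (ι l) ν · ν)) (cong (ι l ⊖_) (ι-· (dot (ι l) ν) ν))
      ; pairing = reflF-pairing
      }
      where
        reflF-pairing : ∀ μ l → dot (μ ⊖ (dot μ ν · ι ν)) (l ⊖ (dot (ι l) ν · ν)) ≡ dot μ l
        reflF-pairing μ l = begin
            dot (μ ⊖ (s · ι ν)) (l ⊖ (t · ν))
              ≡⟨ dot-⊖ˡ μ (s · ι ν) (l ⊖ (t · ν)) ⟩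
            dot μ (l ⊖ (t · ν)) - dot (s · ι ν) (l ⊖ (t · ν))
              ≡⟨ cong₂ _-_ (dot-⊖ʳ μ l (t · ν)) (trans (dot-·ˡ s (ι ν) (l ⊖ (t · ν))) (cong (s *_) (dot-⊖ʳ (ι ν) l (t · ν)))) ⟩
            (dot μ l - dot μ (t · ν)) - s * (dot (ι ν) l - dot (ι ν) (t · ν))
              ≡⟨ cong₂ (λ a b → (dot μ l - a) - s * (dot (ι ν) l - b)) (dot-·ʳ t μ ν) (dot-·ʳ t (ι ν) ν) ⟩
            (dot μ l - t * s) - s * (dot (ι ν) l - t * dot (ι ν) ν)
              ≡⟨ cong₂ (λ a b → (dot μ l - t * s) - s * (a - t * b)) (⟪⟫Q-sym ν l) nν ⟩
            (dot μ l - t * s) - s * (t - t * + 2)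
              ≡⟨ lemma (dot μ l) s t ⟩
            dot μ l ∎
          where
            open ≡-Reasoning
            s : ℤ
            s = dot μ ν
            t : ℤ
            t = dot (ι l) ν
            lemma : ∀ a s t → (a - t * s) - s * (t - t * + 2) ≡ a
            lemma = solve-∀

    reflF-involutiveP : ∀ μ → onP (reflF ν) (onP (reflF ν) μ) ≡ μ
    reflF-involutiveP μ = trans (cong (λ x → onP (reflF ν) μ ⊖ (x · ι ν)) (⟪reflF⟫ μ)) (⊖-·-cancel μ (ι ν) (dot μ ν))

    reflF-involutiveQ : ∀ l → onQ (reflF ν) (onQ (reflF ν) l) ≡ l
    reflF-involutiveQ l =
      trans (cong (λ x → onQ (reflF ν) l ⊖ (x · ν))
                  (trans (cong (λ x → dot x ν) (ι-onQ reflF-isIsometry l)) (⟪reflF⟫ (ι l))))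
            (⊖-·-cancel l ν (dot (ι l) ν))

    reflF-self : onQ (reflF ν) ν ≡ -1ℤ · ν
    reflF-self = trans (cong (λ x → ν ⊖ (x · ν)) nν) (u⊖2u≡-u ν)

  idF-isIsometry : IsIsometry idF
  idF-isIsometry = record
    { onP-⊕ = λ _ _ → refl ; onP-· = λ _ _ → refl ; onQ-⊕ = λ _ _ → refl ; onQ-· = λ _ _ → refl
    ; ι-onQ = λ _ → refl ; pairing = λ _ _ → refl }

  ∘F-isIsometry : ∀ {f g} → IsIsometry f → IsIsometry g → IsIsometry (f ∘F g)
  ∘F-isIsometry {f} {g} isf isg = record
    { onP-⊕ = λ a b → trans (cong (onP f) (onP-⊕ isg a b)) (onP-⊕ isf (onP g a) (onP g b))
    ; onP-· = λ c a → trans (cong (onP f) (onP-· isg c a)) (onP-· isf c (onP g a))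
    ; onQ-⊕ = λ a b → trans (cong (onQ f) (onQ-⊕ isg a b)) (onQ-⊕ isf (onQ g a) (onQ g b))
    ; onQ-· = λ c a → trans (cong (onQ f) (onQ-· isg c a)) (onQ-· isf c (onQ g a))
    ; ι-onQ = λ l → trans (ι-onQ isf (onQ g l)) (cong (onP f) (ι-onQ isg l))
    ; pairing = λ μ l → trans (pairing isf (onP g μ) (onQ g l)) (pairing isg μ l)
    }

  isIsometry-resp : ∀ {f g} → IsIsometry g →
    (∀ μ → onP f μ ≡ onP g μ) → (∀ ν → onQ f ν ≡ onQ g ν) → IsIsometry f
  isIsometry-resp {f} {g} isg eqP eqQ = record
    { onP-⊕ = λ a b → trans (eqP (a ⊕ b)) (trans (onP-⊕ isg a b) (sym (cong₂ _⊕_ (eqP a) (eqP b))))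
    ; onP-· = λ c a → trans (eqP (c · a)) (trans (onP-· isg c a) (sym (cong (c ·_) (eqP a))))
    ; onQ-⊕ = λ a b → trans (eqQ (a ⊕ b)) (trans (onQ-⊕ isg a b) (sym (cong₂ _⊕_ (eqQ a) (eqQ b))))
    ; onQ-· = λ c a → trans (eqQ (c · a)) (trans (onQ-· isg c a) (sym (cong (c ·_) (eqQ a))))
    ; ι-onQ = λ l → trans (cong ι (eqQ l)) (trans (ι-onQ isg l) (sym (eqP (ι l))))
    ; pairing = λ μ l → trans (cong₂ dot (eqP μ) (eqQ l)) (pairing isg μ l)
    }

  wordF-isIsometry : (ws : List (Fin n)) → IsIsometry (wordF ws)
  wordF-isIsometry [] = idF-isIsometry
  wordF-isIsometry (i ∷ ws) = ∘F-isIsometry (reflF-isIsometry (e i) (e-norm2 i)) (wordF-isIsometry ws)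

  finW-isIsometry : ∀ {f} → IsFinW f → IsIsometry f
  finW-isIsometry (ws , eqP , eqQ , _) = isIsometry-resp (wordF-isIsometry ws) eqP eqQ

  wordF-++-onP : (a b : List (Fin n)) (μ : P) → onP (wordF (a ++ b)) μ ≡ onP (wordF a) (onP (wordF b) μ)
  wordF-++-onP [] b μ = refl
  wordF-++-onP (i ∷ a) b μ = cong (onP (reflF (e i))) (wordF-++-onP a b μ)

  wordF-++-onQ : (a b : List (Fin n)) (l : Q) → onQ (wordF (a ++ b)) l ≡ onQ (wordF a) (onQ (wordF b) l)
  wordF-++-onQ [] b l = refl
  wordF-++-onQ (i ∷ a) b l = cong (onQ (reflF (e i))) (wordF-++-onQ a b l)

  wordF-++-onQinv : (a b : List (Fin n)) (l : Q) → onQinv (wordF (a ++ b)) l ≡ onQinv (wordF b) (onQinv (wordF a) l)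
  wordF-++-onQinv [] b l = refl
  wordF-++-onQinv (i ∷ a) b l = wordF-++-onQinv a b (onQinv (reflF (e i)) l)

  wordF-reverse-onQ : (ws : List (Fin n)) (i : Fin n) (l : Q) →
    onQ (wordF (reverse (i ∷ ws))) l ≡ onQ (wordF (reverse ws)) (onQ (reflF (e i)) l)
  wordF-reverse-onQ ws i l =
    trans (cong (λ us → onQ (wordF us) l) (List.unfold-reverse i ws)) (wordF-++-onQ (reverse ws) (i ∷ []) l)

  wordF-reverse-onP : (ws : List (Fin n)) (i : Fin n) (μ : P) →
    onP (wordF (reverse (i ∷ ws))) μ ≡ onP (wordF (reverse ws)) (onP (reflF (e i)) μ)
  wordF-reverse-onP ws i μ =
    trans (cong (λ us → onP (wordF us) μ) (List.unfold-reverse i ws)) (wordF-++-onP (reverse ws) (i ∷ []) μ)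

  wordF-onQinv : (ws : List (Fin n)) (l : Q) → onQinv (wordF ws) l ≡ onQ (wordF (reverse ws)) l
  wordF-onQinv [] l = refl
  wordF-onQinv (i ∷ ws) l = trans (wordF-onQinv ws (onQ (reflF (e i)) l)) (sym (wordF-reverse-onQ ws i l))

  wordF-reverse-inverseQ : (ws : List (Fin n)) (l : Q) → onQ (wordF ws) (onQ (wordF (reverse ws)) l) ≡ l
  wordF-reverse-inverseQ [] l = refl
  wordF-reverse-inverseQ (i ∷ ws) l = begin
    onQ (reflF (e i)) (onQ (wordF ws) (onQ (wordF (reverse (i ∷ ws))) l))
      ≡⟨ cong (λ x → onQ (reflF (e i)) (onQ (wordF ws) x)) (wordF-reverse-onQ ws i l) ⟩
    onQ (reflF (e i)) (onQ (wordF ws) (onQ (wordF (reverse ws)) (onQ (reflF (e i)) l)))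
      ≡⟨ cong (onQ (reflF (e i))) (wordF-reverse-inverseQ ws (onQ (reflF (e i)) l)) ⟩
    onQ (reflF (e i)) (onQ (reflF (e i)) l)
      ≡⟨ reflF-involutiveQ (e i) (e-norm2 i) l ⟩
    l ∎
    where open ≡-Reasoning

  wordF-reverse-inverseP : (ws : List (Fin n)) (μ : P) → onP (wordF ws) (onP (wordF (reverse ws)) μ) ≡ μ
  wordF-reverse-inverseP [] μ = refl
  wordF-reverse-inverseP (i ∷ ws) μ = begin
    onP (reflF (e i)) (onP (wordF ws) (onP (wordF (reverse (i ∷ ws))) μ))
      ≡⟨ cong (λ x → onP (reflF (e i)) (onP (wordF ws) x)) (wordF-reverse-onP ws i μ) ⟩
    onP (reflF (e i)) (onP (wordF ws) (onP (wordF (reverse ws)) (onP (reflF (e i)) μ)))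
      ≡⟨ cong (onP (reflF (e i))) (wordF-reverse-inverseP ws (onP (reflF (e i)) μ)) ⟩
    onP (reflF (e i)) (onP (reflF (e i)) μ)
      ≡⟨ reflF-involutiveP (e i) (e-norm2 i) μ ⟩
    μ ∎
    where open ≡-Reasoning

  palindrome : (ws : List (Fin n)) (i : Fin n) → reverse (ws ++ i ∷ reverse ws) ≡ ws ++ i ∷ reverse ws
  palindrome ws i = begin
    reverse (ws ++ i ∷ reverse ws)                  ≡⟨ List.reverse-++ ws (i ∷ reverse ws) ⟩
    reverse (i ∷ reverse ws) ++ reverse ws          ≡⟨ cong (_++ reverse ws) (List.unfold-reverse i (reverse ws)) ⟩
    (reverse (reverse ws) ++ i ∷ []) ++ reverse ws  ≡⟨ cong (λ us → (us ++ i ∷ []) ++ reverse ws) (List.reverse-involutive ws) ⟩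
    (ws ++ i ∷ []) ++ reverse ws                    ≡⟨ List.++-assoc ws (i ∷ []) (reverse ws) ⟩
    ws ++ i ∷ reverse ws                            ∎
    where open ≡-Reasoning

  module _ (ws : List (Fin n)) (i : Fin n) where
    private
      w : FinEl
      w = wordF ws
      isw : IsIsometry w
      isw = wordF-isIsometry ws
      u : Q
      u = onQ w (e i)

    conjugate-onQ : ∀ l → onQ (wordF (ws ++ i ∷ reverse ws)) l ≡ onQ (reflF u) l
    conjugate-onQ l = begin
        onQ (wordF (ws ++ i ∷ reverse ws)) l
          ≡⟨ wordF-++-onQ ws (i ∷ reverse ws) l ⟩
        onQ w (l′ ⊖ (t · e i))
          ≡⟨ onQ-⊖ isw l′ (t · e i) ⟩
        onQ w l′ ⊖ onQ w (t · e i)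
          ≡⟨ cong₂ _⊖_ (wordF-reverse-inverseQ ws l) (onQ-· isw t (e i)) ⟩
        l ⊖ (t · u)
          ≡⟨ cong (λ x → l ⊖ (x · u)) t≡ ⟩
        l ⊖ (dot (ι l) u · u) ∎
      where
        open ≡-Reasoning
        l′ : Q
        l′ = onQ (wordF (reverse ws)) l
        t : ℤ
        t = dot (ι l′) (e i)
        t≡ : t ≡ dot (ι l) u
        t≡ = trans (sym (pairingQ isw l′ (e i))) (cong (λ x → dot (ι x) u) (wordF-reverse-inverseQ ws l))

    conjugate-onP : ∀ μ → onP (wordF (ws ++ i ∷ reverse ws)) μ ≡ onP (reflF u) μ
    conjugate-onP μ = begin
        onP (wordF (ws ++ i ∷ reverse ws)) μ
          ≡⟨ wordF-++-onP ws (i ∷ reverse ws) μ ⟩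
        onP w (μ′ ⊖ (s · ι (e i)))
          ≡⟨ onP-⊖ isw μ′ (s · ι (e i)) ⟩
        onP w μ′ ⊖ onP w (s · ι (e i))
          ≡⟨ cong₂ _⊖_ (wordF-reverse-inverseP ws μ) (trans (onP-· isw s (ι (e i))) (cong (s ·_) (sym (ι-onQ isw (e i))))) ⟩
        μ ⊖ (s · ι u)
          ≡⟨ cong (λ x → μ ⊖ (x · ι u)) s≡ ⟩
        μ ⊖ (dot μ u · ι u) ∎
      where
        open ≡-Reasoning
        μ′ : P
        μ′ = onP (wordF (reverse ws)) μ
        s : ℤ
        s = dot μ′ (e i)
        s≡ : s ≡ dot μ u
        s≡ = trans (sym (pairing isw μ′ (e i))) (cong (λ x → dot x u) (wordF-reverse-inverseP ws μ))

    conjugate-finW : IsFinW (reflF u)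
    conjugate-finW = ws ++ i ∷ reverse ws
                   , (λ μ → sym (conjugate-onP μ))
                   , (λ l → sym (conjugate-onQ l))
                   , (λ l → sym (trans (wordF-onQinv (ws ++ i ∷ reverse ws) l)
                                (trans (cong (λ us → onQ (wordF us) l) (palindrome ws i)) (conjugate-onQ l))))

  root-norm2 : ∀ {ν} → IsRoot ν → Norm2 ν
  root-norm2 (ws , i , refl) = trans (pairingQ (wordF-isIsometry ws) (e i) (e i)) (e-norm2 i)

  reflF-finW : ∀ {ν} → IsRoot ν → IsFinW (reflF ν)
  reflF-finW (ws , i , refl) = conjugate-finW ws i

  root-neg : ∀ {ν} → IsRoot ν → IsRoot (-1ℤ · ν)
  root-neg (ws , i , refl) = ws ++ i ∷ [] , i , sym (begin
    onQ (wordF (ws ++ i ∷ [])) (e i)     ≡⟨ wordF-++-onQ ws (i ∷ []) (e i) ⟩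
    onQ (wordF ws) (onQ (reflF (e i)) (e i)) ≡⟨ cong (onQ (wordF ws)) (reflF-self (e i) (e-norm2 i)) ⟩
    onQ (wordF ws) (-1ℤ · e i)           ≡⟨ onQ-· (wordF-isIsometry ws) -1ℤ (e i) ⟩
    -1ℤ · onQ (wordF ws) (e i)           ∎)
    where open ≡-Reasoning

  finW-root : ∀ {f ν} → IsFinW f → IsRoot ν → IsRoot (onQ f ν)
  finW-root (vs , _ , eqQ , _) (ws , i , refl) = vs ++ ws , i , trans (eqQ _) (sym (wordF-++-onQ vs ws (e i)))

  finW-∘ : ∀ {f g} → IsFinW f → IsFinW g → IsFinW (f ∘F g)
  finW-∘ {f} {g} (a , aP , aQ , aI) (b , bP , bQ , bI) = a ++ b
    , (λ μ → trans (cong (onP f) (bP μ)) (trans (aP _) (sym (wordF-++-onP a b μ))))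
    , (λ l → trans (cong (onQ f) (bQ l)) (trans (aQ _) (sym (wordF-++-onQ a b l))))
    , (λ l → trans (cong (onQinv g) (aI l)) (trans (bI _) (sym (wordF-++-onQinv a b l))))

  finW-inverseʳ : ∀ {f} → IsFinW f → ∀ l → onQ f (onQinv f l) ≡ l
  finW-inverseʳ {f} (ws , _ , eqQ , eqI) l =
    trans (eqQ _) (trans (cong (onQ (wordF ws)) (trans (eqI l) (wordF-onQinv ws l))) (wordF-reverse-inverseQ ws l))

  finW-onQinv-pairingQ : ∀ {f} → IsFinW f → ∀ a b → ⟪ onQinv f a , onQinv f b ⟫Q ≡ ⟪ a , b ⟫Q
  finW-onQinv-pairingQ {f} (ws , _ , _ , eqI) a b =
    trans (cong₂ (λ x y → dot (ι x) y) (trans (eqI a) (wordF-onQinv ws a)) (trans (eqI b) (wordF-onQinv ws b)))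
          (pairingQ (wordF-isIsometry (reverse ws)) a b)

  finW-onQinv-· : ∀ {f} → IsFinW f → ∀ c a → onQinv f (c · a) ≡ c · onQinv f a
  finW-onQinv-· {f} (ws , _ , _ , eqI) c a =
    trans (trans (eqI (c · a)) (wordF-onQinv ws (c · a)))
          (trans (onQ-· (wordF-isIsometry (reverse ws)) c a) (cong (c ·_) (sym (trans (eqI a) (wordF-onQinv ws a)))))

module AffineAction (R : SimplyLacedCartan) where
  open RootData R
  open RootDatum R

  reflF-adjointQ : ∀ ν l μ → ⟪ onQ (reflF ν) l , μ ⟫Q ≡ ⟪ l , onQ (reflF ν) μ ⟫Q
  reflF-adjointQ ν l μ = begin
      dot (ι (l ⊖ (t · ν))) μ
        ≡⟨ cong (λ x → dot x μ) (trans (ι-⊖ l (t · ν)) (cong (ι l ⊖_) (ι-· t ν))) ⟩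
      dot (ι l ⊖ (t · ι ν)) μ
        ≡⟨ trans (dot-⊖ˡ (ι l) (t · ι ν) μ) (cong (_-_ (dot (ι l) μ)) (dot-·ˡ t (ι ν) μ)) ⟩
      dot (ι l) μ - t * dot (ι ν) μ
        ≡⟨ cong (λ x → dot (ι l) μ - x) (trans (cong (t *_) (⟪⟫Q-sym ν μ)) (ℤ.*-comm t s)) ⟩
      dot (ι l) μ - s * t
        ≡⟨ sym (trans (dot-⊖ʳ (ι l) μ (s · ν)) (cong (_-_ (dot (ι l) μ)) (dot-·ʳ s (ι l) ν))) ⟩
      dot (ι l) (μ ⊖ (s · ν)) ∎
    where
      open ≡-Reasoning
      t : ℤ
      t = dot (ι l) ν
      s : ℤ
      s = dot (ι μ) ν

  reflF-adjointP : ∀ ν μ l → ⟪ onP (reflF ν) μ , l ⟫ ≡ ⟪ μ , onQ (reflF ν) l ⟫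
  reflF-adjointP ν μ l = begin
      dot (μ ⊖ (s · ι ν)) l
        ≡⟨ trans (dot-⊖ˡ μ (s · ι ν) l) (cong (_-_ (dot μ l)) (dot-·ˡ s (ι ν) l)) ⟩
      dot μ l - s * dot (ι ν) l
        ≡⟨ cong (λ x → dot μ l - x) (trans (cong (s *_) (⟪⟫Q-sym ν l)) (ℤ.*-comm s t)) ⟩
      dot μ l - t * s
        ≡⟨ sym (trans (dot-⊖ʳ μ l (t · ν)) (cong (_-_ (dot μ l)) (dot-·ʳ t μ ν))) ⟩
      dot μ (l ⊖ (t · ν)) ∎
    where
      open ≡-Reasoning
      t : ℤ
      t = dot (ι l) ν
      s : ℤ
      s = dot μ ν

  actX-actR-pairing : ∀ (u : Waff) → IsIsometry (lin u) → ∀ ζ ρ → ⟪ actX u ζ , actR u ρ ⟫X ≡ ⟪ ζ , ρ ⟫X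
  actX-actR-pairing (Y τ ⋆ f) isf (mkX μ m l) (ν +δ k) = begin
      dot (onP f μ ⊕ (l · ι τ)) (onQ f ν) + l * (k - dot (ι τ) (onQ f ν))
        ≡⟨ cong (λ x → x + l * (k - dot (ι τ) (onQ f ν))) (trans (dot-⊕ˡ (onP f μ) (l · ι τ) (onQ f ν))
              (cong₂ _+_ (pairing isf μ ν) (dot-·ˡ l (ι τ) (onQ f ν)))) ⟩
      (dot μ ν + l * dot (ι τ) (onQ f ν)) + l * (k - dot (ι τ) (onQ f ν))
        ≡⟨ lemma (dot μ ν) l (dot (ι τ) (onQ f ν)) k ⟩
      dot μ ν + l * k ∎
    where
      open ≡-Reasoning
      lemma : ∀ a l b k → (a + l * b) + l * (k - b) ≡ a + l * k
      lemma = solve-∀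

  pairing-negA : ∀ ζ ρ → ⟪ ζ , negA ρ ⟫X ≡ - ⟪ ζ , ρ ⟫X
  pairing-negA (mkX μ m l) (ν +δ k) = trans (cong (λ x → x + l * (- k)) (dot-·ʳ -1ℤ μ ν)) (lemma (dot μ ν) l k)
    where lemma : ∀ a l k → - + 1 * a + l * (- k) ≡ - (a + l * k)
          lemma = solve-∀

  invR-sAff-∘A : ∀ γ (u : Waff) ρ → invR (sAff γ ∘A u) ρ ≡ invR u (invR (sAff γ) ρ)
  invR-sAff-∘A (ν +δ k) (Y τ ⋆ f) (μ +δ k′) = cong (λ x → onQinv f (onQinv (reflF ν) μ) +δ x) (begin
      k′ + dot (ι (σ ⊕ onQ (reflF ν) τ)) μ
        ≡⟨ cong (_+_ k′) (trans (cong (λ x → dot x μ) (ι-⊕ σ (onQ (reflF ν) τ))) (dot-⊕ˡ (ι σ) (ι (onQ (reflF ν) τ)) μ)) ⟩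
      k′ + (dot (ι σ) μ + dot (ι (onQ (reflF ν) τ)) μ)
        ≡⟨ cong (λ x → k′ + (dot (ι σ) μ + x)) (reflF-adjointQ ν τ μ) ⟩
      k′ + (dot (ι σ) μ + dot (ι τ) (onQ (reflF ν) μ))
        ≡⟨ sym (ℤ.+-assoc k′ (dot (ι σ) μ) _) ⟩
      k′ + dot (ι σ) μ + dot (ι τ) (onQ (reflF ν) μ) ∎)
    where
      open ≡-Reasoning
      σ : Q
      σ = (- k) · ν

  sD-weight-pairing : ∀ γ a ζ ρ → ⟪ wt (sD (γ +π a) (X^ ζ ⋆ idA)) , ρ ⟫X
                                ≡ (- a) * ⟪ rt γ , rt ρ ⟫Q + ⟪ ζ , invR (sAff γ) ρ ⟫X
  sD-weight-pairing (ν +δ k) a (mkX μ m l) (ν′ +δ k′) = begin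
      dot (((- a) · ι ν) ⊕ (onP s μ ⊕ (l · ι σ))) ν′ + ((- a) * + 0 + l) * k′
        ≡⟨ cong (λ x → x + ((- a) * + 0 + l) * k′) (trans (dot-⊕ˡ ((- a) · ι ν) _ ν′)
              (cong₂ _+_ (dot-·ˡ (- a) (ι ν) ν′) (trans (dot-⊕ˡ (onP s μ) (l · ι σ) ν′)
                 (cong₂ _+_ (reflF-adjointP ν μ ν′) (dot-·ˡ l (ι σ) ν′))))) ⟩
      ((- a) * dot (ι ν) ν′ + (dot μ (onQ s ν′) + l * dot (ι σ) ν′)) + ((- a) * + 0 + l) * k′
        ≡⟨ lemma (- a) (dot (ι ν) ν′) (dot μ (onQ s ν′)) l (dot (ι σ) ν′) k′ ⟩
      (- a) * dot (ι ν) ν′ + (dot μ (onQ s ν′) + l * (k′ + dot (ι σ) ν′)) ∎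
    where
      open ≡-Reasoning
      s : FinEl
      s = reflF ν
      σ : Q
      σ = (- k) · ν
      lemma : ∀ A B C l D k′ → (A * B + (C + l * D)) + (A * + 0 + l) * k′ ≡ A * B + (C + l * (k′ + D))
      lemma = solve-∀

  module Dihedral (ν : Q) (k : ℤ) (nν : Norm2 ν) where
    γ : AffRoot
    γ = ν +δ k

    -- s_γ = Y^σ s_ν, and halfNorm is the ⟨σ, σ⟩/2 in the δ-coefficient of its action on X.
    private
      s : FinEl
      s = reflF ν
      isS : IsIsometry s
      isS = reflF-isIsometry ν nν
      σ : Q
      σ = (- k) · ν
      halfNorm : ℤ
      halfNorm = ⟪ σ , σ ⟫Q /ℕ 2
      S : X → X
      S = actX (sAff γ)
      g : X
      g = ιX γ

      ⟪σ,_⟫ : ∀ w → ⟪ σ , w ⟫Q ≡ (- k) * ⟪ ν , w ⟫Q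
      ⟪σ, w ⟫ = trans (cong (λ x → dot x w) (ι-· (- k) ν)) (dot-·ˡ (- k) (ι ν) w)

      ⟪ν,-ν⟫ : ⟪ ν , -1ℤ · ν ⟫Q ≡ -1ℤ * + 2
      ⟪ν,-ν⟫ = trans (dot-·ʳ -1ℤ (ι ν) ν) (cong (-1ℤ *_) nν)

    invR-sAff-self : invR (sAff γ) γ ≡ negA γ
    invR-sAff-self = cong₂ _+δ_ (reflF-self ν nν) (trans (cong (_+_ k) (trans ⟪σ, ν ⟫ (cong ((- k) *_) nν))) (lemma k))
      where lemma : ∀ k → k + (- k) * + 2 ≡ - k
            lemma = solve-∀

    invR-sAff-negA-self : invR (sAff γ) (negA γ) ≡ γ
    invR-sAff-negA-self = cong₂ _+δ_
      (trans (onQ-· isS -1ℤ ν) (trans (cong (-1ℤ ·_) (reflF-self ν nν)) (trans (·-assoc -1ℤ -1ℤ ν) (·-identityˡ ν))))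
      (trans (cong (_+_ (- k)) (trans ⟪σ, -1ℤ · ν ⟫ (cong ((- k) *_) ⟪ν,-ν⟫))) (lemma k))
      where lemma : ∀ k → - k + (- k) * (- + 1 * + 2) ≡ k
            lemma = solve-∀

    invW-sD-γ : ∀ a ζ u p → invW (sD (γ +π a) (X^ ζ ⋆ u)) (γ +π p) ≡ invW (X^ ζ ⋆ u) (negA γ +π (p - + 2 * a))
    invW-sD-γ a ζ u p = cong₂ _+π_ (trans (invR-sAff-∘A γ u γ) (cong (invR u) invR-sAff-self))
      (trans (cong (_+_ p) (sD-weight-pairing γ a ζ γ))
        (trans (cong₂ (λ x y → p + ((- a) * x + ⟪ ζ , y ⟫X)) nν invR-sAff-self) (lemma p a ⟪ ζ , negA γ ⟫X)))
      where lemma : ∀ p a c → p + ((- a) * + 2 + c) ≡ (p - + 2 * a) + c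
            lemma = solve-∀

    invW-sD-negA-γ : ∀ a ζ u p → invW (sD (γ +π a) (X^ ζ ⋆ u)) (negA γ +π p) ≡ invW (X^ ζ ⋆ u) (γ +π (p + + 2 * a))
    invW-sD-negA-γ a ζ u p = cong₂ _+π_ (trans (invR-sAff-∘A γ u (negA γ)) (cong (invR u) invR-sAff-negA-self))
      (trans (cong (_+_ p) (sD-weight-pairing γ a ζ (negA γ)))
        (trans (cong₂ (λ x y → p + ((- a) * x + ⟪ ζ , y ⟫X)) ⟪ν,-ν⟫ invR-sAff-negA-self) (lemma p a ⟪ ζ , γ ⟫X)))
      where lemma : ∀ p a c → p + ((- a) * (- + 1 * + 2) + c) ≡ (p + + 2 * a) + c
            lemma = solve-∀

    private
      reflF-σ : onQ s σ ≡ -1ℤ · σ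
      reflF-σ = begin
        onQ s ((- k) · ν)      ≡⟨ onQ-· isS (- k) ν ⟩
        (- k) · onQ s ν        ≡⟨ cong ((- k) ·_) (reflF-self ν nν) ⟩
        (- k) · (-1ℤ · ν)      ≡⟨ ·-assoc (- k) -1ℤ ν ⟩
        ((- k) * -1ℤ) · ν      ≡⟨ cong (_· ν) (ℤ.*-comm (- k) -1ℤ) ⟩
        (-1ℤ * (- k)) · ν      ≡⟨ sym (·-assoc -1ℤ (- k) ν) ⟩
        -1ℤ · σ                ∎
        where open ≡-Reasoning

      reflF-ισ : onP s (ι σ) ≡ -1ℤ · ι σ
      reflF-ισ = trans (sym (ι-onQ isS σ)) (trans (cong ι reflF-σ) (ι-· -1ℤ σ))

      reflF-ιν : onP s (ι ν) ≡ -1ℤ · ι ν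
      reflF-ιν = trans (sym (ι-onQ isS ν)) (trans (cong ι (reflF-self ν nν)) (ι-· -1ℤ ν))

      ⟪σ,σ⟫ : ⟪ σ , σ ⟫Q ≡ ((- k) * (- k)) * + 2
      ⟪σ,σ⟫ = trans ⟪σ, σ ⟫ (trans (cong ((- k) *_) (trans (dot-·ʳ (- k) (ι ν) ν) (cong ((- k) *_) nν)))
                                  (sym (ℤ.*-assoc (- k) (- k) (+ 2))))

      halfNorm≡ : halfNorm ≡ (- k) * (- k)
      halfNorm≡ = trans (cong (_/ℕ 2) ⟪σ,σ⟫) ([i*2]/ℕ2≡i ((- k) * (- k)))

    actX-sAff-⊕X : ∀ A B → S (A ⊕X B) ≡ S A ⊕X S B
    actX-sAff-⊕X (mkX μ₁ m₁ l₁) (mkX μ₂ m₂ l₂) = cong₂ (λ x y → mkX x y (l₁ + l₂))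
      (trans (cong (_⊕ ((l₁ + l₂) · ι σ)) (onP-⊕ isS μ₁ μ₂)) (interchange (onP s μ₁) (onP s μ₂) (ι σ) l₁ l₂))
      (trans (cong (λ t → (m₁ + m₂) - t - (l₁ + l₂) * halfNorm)
                   (trans (cong (λ t → dot t σ) (onP-⊕ isS μ₁ μ₂)) (dot-⊕ˡ (onP s μ₁) (onP s μ₂) σ)))
             (lemma m₁ m₂ (dot (onP s μ₁) σ) (dot (onP s μ₂) σ) l₁ l₂ halfNorm))
      where
        lemma : ∀ m₁ m₂ d₁ d₂ l₁ l₂ K → (m₁ + m₂) - (d₁ + d₂) - (l₁ + l₂) * K ≡ (m₁ - d₁ - l₁ * K) + (m₂ - d₂ - l₂ * K)
        lemma = solve-∀
        interchange : ∀ {m} (a b c : Vec ℤ m) x y → (a ⊕ b) ⊕ ((x + y) · c) ≡ (a ⊕ (x · c)) ⊕ (b ⊕ (y · c))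
        interchange [] [] [] x y = refl
        interchange (a ∷ as) (b ∷ bs) (c ∷ cs) x y = cong₂ _∷_ (pointwise a b c x y) (interchange as bs cs x y)
          where pointwise : ∀ a b c x y → (a + b) + (x + y) * c ≡ (a + x * c) + (b + y * c)
                pointwise = solve-∀

    actX-sAff-·X : ∀ c A → S (c ·X A) ≡ c ·X S A
    actX-sAff-·X c (mkX μ m l) = cong₂ (λ x y → mkX x y (c * l))
      (trans (cong (_⊕ ((c * l) · ι σ)) (onP-· isS c μ))
             (trans (cong ((c · onP s μ) ⊕_) (sym (·-assoc c l (ι σ)))) (sym (·-distribˡ-⊕ c (onP s μ) (l · ι σ)))))
      (trans (cong (λ t → (c * m) - t - (c * l) * halfNorm) (trans (cong (λ t → dot t σ) (onP-· isS c μ)) (dot-·ˡ c (onP s μ) σ)))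
             (lemma c m (dot (onP s μ) σ) l halfNorm))
      where lemma : ∀ c m d l K → (c * m) - c * d - (c * l) * K ≡ c * (m - d - l * K)
            lemma = solve-∀

    actX-sAff-γ : S g ≡ -1ℤ ·X g
    actX-sAff-γ = cong₂ (λ x y → mkX x y (+ 0))
      (trans (cong (onP s (ι ν) ⊕_) (·-zeroˡ (ι σ))) (trans (⊕-zeroʳ (onP s (ι ν))) reflF-ιν))
      (trans (cong (λ t → k - t - + 0 * halfNorm)
                   (trans (cong (λ t → dot t σ) reflF-ιν) (trans (dot-·ˡ -1ℤ (ι ν) σ) (cong (-1ℤ *_) (trans (dot-·ʳ (- k) (ι ν) ν) (cong ((- k) *_) nν))))))
             (lemma k halfNorm))
      where lemma : ∀ k K → k - - + 1 * ((- k) * + 2) - + 0 * K ≡ - + 1 * k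
            lemma = solve-∀

    actX-sAff-involutive : ∀ ζ → S (S ζ) ≡ ζ
    actX-sAff-involutive (mkX μ m l) = cong₂ (λ x y → mkX x y l) fin-eq
      (trans (cong₂ (λ a t → (m - a - l * halfNorm) - t - l * halfNorm) (reflF-adjointP ν μ σ) (cong (λ t → dot t σ) fin-step))
        (trans (cong₂ (λ a t → (m - dot μ a - l * halfNorm) - t - l * halfNorm) reflF-σ
                      (trans (dot-⊕ˡ μ (l · (-1ℤ · ι σ)) σ) (cong (_+_ (dot μ σ)) (trans (dot-·ˡ l (-1ℤ · ι σ) σ) (cong (l *_) (dot-·ˡ -1ℤ (ι σ) σ))))))
        (trans (cong (λ a → (m - a - l * halfNorm) - (dot μ σ + l * (-1ℤ * dot (ι σ) σ)) - l * halfNorm) (dot-·ʳ -1ℤ μ σ))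
        (trans (cong₂ (λ a t → (m - -1ℤ * dot μ σ - l * a) - (dot μ σ + l * (-1ℤ * t)) - l * a) halfNorm≡ ⟪σ,σ⟫)
               (lemma m (dot μ σ) l (- k))))))
      where
        fin-step : onP s (onP s μ ⊕ (l · ι σ)) ≡ μ ⊕ (l · (-1ℤ · ι σ))
        fin-step = trans (onP-⊕ isS (onP s μ) (l · ι σ))
                         (cong₂ _⊕_ (reflF-involutiveP ν nν μ) (trans (onP-· isS l (ι σ)) (cong (l ·_) reflF-ισ)))
        cancel : ∀ {m} (a b : Vec ℤ m) x → (a ⊕ (x · (-1ℤ · b))) ⊕ (x · b) ≡ a
        cancel [] [] x = refl
        cancel (a ∷ as) (b ∷ bs) x = cong₂ _∷_ (pointwise a b x) (cancel as bs x)
          where pointwise : ∀ a b x → (a + x * (- + 1 * b)) + x * b ≡ a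
                pointwise = solve-∀
        fin-eq : onP s (onP s μ ⊕ (l · ι σ)) ⊕ (l · ι σ) ≡ μ
        fin-eq = trans (cong (_⊕ (l · ι σ)) fin-step) (cancel μ (ι σ) l)
        lemma : ∀ m d l q → (m - - + 1 * d - l * (q * q)) - (d + l * (- + 1 * ((q * q) * + 2))) - l * (q * q) ≡ m
        lemma = solve-∀

    private
      shift-past-sAff : ∀ a c Z → ((- a) ·X g) ⊕X S ((c ·X g) ⊕X Z) ≡ ((- a - c) ·X g) ⊕X S Z
      shift-past-sAff a c Z = trans
        (cong (((- a) ·X g) ⊕X_) (trans (actX-sAff-⊕X (c ·X g) Z) (cong (_⊕X S Z) (trans (actX-sAff-·X c g) (cong (c ·X_) actX-sAff-γ)))))
        (collect (- a) c g (S Z))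
        where
          collectV : ∀ {m} (a z : Vec ℤ m) x y → (x · a) ⊕ ((y · (-1ℤ · a)) ⊕ z) ≡ ((x - y) · a) ⊕ z
          collectV [] [] x y = refl
          collectV (a ∷ as) (z ∷ zs) x y = cong₂ _∷_ (pointwise x y a z) (collectV as zs x y)
            where pointwise : ∀ x y a z → x * a + (y * (- + 1 * a) + z) ≡ (x - y) * a + z
                  pointwise = solve-∀
          collect : ∀ x y (G Z : X) → (x ·X G) ⊕X ((y ·X (-1ℤ ·X G)) ⊕X Z) ≡ ((x - y) ·X G) ⊕X Z
          collect x y (mkX a gm gl) (mkX z zm zl) =
            cong₂ (λ p q → mkX p (proj₁ q) (proj₂ q)) (collectV a z x y) (cong₂ _,_ (pointwise x y gm zm) (pointwise x y gl zl))
            where pointwise : ∀ x y a z → x * a + (y * (- + 1 * a) + z) ≡ (x - y) * a + z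
                  pointwise = solve-∀

    sD-three-reflections : ∀ a₁ a₂ a₃ ζ u →
      sD (γ +π (a₁ - a₂ + a₃)) (X^ ζ ⋆ u) ≈W sD (γ +π a₃) (sD (γ +π a₂) (sD (γ +π a₁) (X^ ζ ⋆ u)))
    sD-three-reflections a₁ a₂ a₃ ζ (Y τ ⋆ f) =
        weight-eq , translation-eq
      , (λ μ → sym (reflF-involutiveP ν nν (onP s (onP f μ))))
      , (λ l → sym (reflF-involutiveQ ν nν (onQ s (onQ f l))))
      , (λ l → cong (onQinv f) (sym (reflF-involutiveQ ν nν (onQ s l))))
      where
        c₂ : ℤ
        c₂ = - a₂ - (- a₁)
        two-steps : ((- a₂) ·X g) ⊕X S (((- a₁) ·X g) ⊕X S ζ) ≡ (c₂ ·X g) ⊕X ζ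
        two-steps = trans (shift-past-sAff a₂ (- a₁) (S ζ)) (cong ((c₂ ·X g) ⊕X_) (actX-sAff-involutive ζ))
        weight-eq : ((- (a₁ - a₂ + a₃)) ·X g) ⊕X S ζ ≡ ((- a₃) ·X g) ⊕X S (((- a₂) ·X g) ⊕X S (((- a₁) ·X g) ⊕X S ζ))
        weight-eq = sym (trans (cong (λ t → ((- a₃) ·X g) ⊕X S t) two-steps)
                        (trans (shift-past-sAff a₃ c₂ ζ) (cong (λ t → (t ·X g) ⊕X S ζ) (lemma a₁ a₂ a₃))))
          where lemma : ∀ a₁ a₂ a₃ → - a₃ - (- a₂ - (- a₁)) ≡ - (a₁ - a₂ + a₃)
                lemma = solve-∀
        absorb : ∀ {m} (a b : Vec ℤ m) → a ⊕ ((-1ℤ · a) ⊕ (a ⊕ b)) ≡ a ⊕ b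
        absorb [] [] = refl
        absorb (a ∷ as) (b ∷ bs) = cong₂ _∷_ (pointwise a b) (absorb as bs)
          where pointwise : ∀ a b → a + (- + 1 * a + (a + b)) ≡ a + b
                pointwise = solve-∀
        translation-eq : σ ⊕ onQ s τ ≡ σ ⊕ onQ s (σ ⊕ onQ s (σ ⊕ onQ s τ))
        translation-eq = sym (trans (cong (σ ⊕_) (trans (onQ-⊕ isS σ (onQ s (σ ⊕ onQ s τ)))
                                                        (cong₂ _⊕_ reflF-σ (reflF-involutiveQ ν nν (σ ⊕ onQ s τ)))))
                                    (absorb σ (onQ s τ)))

module Positivity (R : SimplyLacedCartan) where
  open RootData R
  open RootDatum R

  NonNeg? : (μ : Q) → Dec (NonNeg μ)
  NonNeg? μ = Fin.all? (λ i → + 0 ≤? lookup μ i)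

  PosAff? : (ρ : AffRoot) → Dec (PosAff ρ)
  PosAff? (μ +δ k) with + 0 <? k | k ℤ.≟ + 0 | NonNeg? μ
  ... | yes 0<k | _       | _      = yes (inj₁ 0<k)
  ... | no 0≮k  | no k≢0  | _      = no λ { (inj₁ 0<k) → 0≮k 0<k ; (inj₂ (k≡0 , _)) → k≢0 k≡0 }
  ... | no 0≮k  | yes k≡0 | yes μ≥0 = yes (inj₂ (k≡0 , μ≥0))
  ... | no 0≮k  | yes _   | no μ≱0 = no λ { (inj₁ 0<k) → 0≮k 0<k ; (inj₂ (_ , μ≥0)) → μ≱0 μ≥0 }

  DPos-of-positive : ∀ ρ {q} → + 0 < q → DPos (ρ +π q)
  DPos-of-positive ρ 0<q with PosAff? ρ
  ... | yes ρ>0 = inj₁ (ρ>0 , ℤ.<⇒≤ 0<q)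
  ... | no ρ≯0 = inj₂ (ρ≯0 , 0<q)

  DNeg-of-negative : ∀ ρ {q} → q < + 0 → DNeg (ρ +π q)
  DNeg-of-negative ρ q<0 (inj₁ (_ , 0≤q)) = ℤ.<⇒≱ q<0 0≤q
  DNeg-of-negative ρ q<0 (inj₂ (_ , 0<q)) = ℤ.<-asym q<0 0<q

  DNeg-of-zero : ∀ ρ {q} → q ≡ + 0 → ¬ PosAff ρ → DNeg (ρ +π q)
  DNeg-of-zero ρ q≡0 ρ≯0 (inj₁ (ρ>0 , _)) = ρ≯0 ρ>0
  DNeg-of-zero ρ q≡0 ρ≯0 (inj₂ (_ , 0<q)) = ℤ.<-irrefl (sym q≡0) 0<q

  DPos⇒0≤coefficient : ∀ ρ {q} → DPos (ρ +π q) → + 0 ≤ q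
  DPos⇒0≤coefficient _ (inj₁ (_ , 0≤q)) = 0≤q
  DPos⇒0≤coefficient _ (inj₂ (_ , 0<q)) = ℤ.<⇒≤ 0<q

  PosAff-opposite : ∀ ρ → Norm2 (rt ρ) → PosAff ρ → ¬ PosAff (negA ρ)
  PosAff-opposite (ν +δ k) _ (inj₁ 0<k) (inj₁ 0<-k) = ℤ.<-asym 0<k (ℤ.neg-cancel-< {+ 0} 0<-k)
  PosAff-opposite (ν +δ k) _ (inj₁ 0<k) (inj₂ (-k≡0 , _)) = ℤ.<-irrefl (sym (ℤ.neg-injective -k≡0)) 0<k
  PosAff-opposite (ν +δ k) _ (inj₂ (refl , _)) (inj₁ 0<-k) = ℤ.<-irrefl refl 0<-k
  PosAff-opposite (ν +δ k) nν (inj₂ (_ , ν≥0)) (inj₂ (_ , -ν≥0)) with ν≡0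
    where
      ν≡0 : ν ≡ zeroV
      ν≡0 = Vec-ext λ i → trans
        (ℤ.≤-antisym (ℤ.neg-cancel-≤ (subst (+ 0 ≤_) (trans (lookup-· -1ℤ ν i) (ℤ.-1*i≡-i (lookup ν i))) (-ν≥0 i))) (ν≥0 i))
        (sym (lookup-zeroV i))
  ... | refl with trans (sym (dot-zeroʳ (ι zeroV))) nν
  ...   | ()

  DPos-opposite : ∀ ρ {q} → Norm2 (rt ρ) → DPos (ρ +π q) → ¬ DPos (negA ρ +π (- q))
  DPos-opposite ρ nρ pos (inj₂ (_ , 0<-q)) = ℤ.<⇒≱ (ℤ.neg-cancel-< {+ 0} 0<-q) (DPos⇒0≤coefficient ρ pos)
  DPos-opposite ρ nρ (inj₂ (_ , 0<q)) (inj₁ (_ , 0≤-q)) = ℤ.<⇒≱ 0<q (ℤ.neg-cancel-≤ 0≤-q)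
  DPos-opposite ρ nρ (inj₁ (ρ>0 , _)) (inj₁ (-ρ>0 , _)) = PosAff-opposite ρ nρ ρ>0 -ρ>0

module ReflectionUniqueness (R : SimplyLacedCartan) where
  open RootData R
  open RootDatum R
  open AffineAction R

  private
    ⟪ν,·ν⟫ : ∀ {ν} → Norm2 ν → ∀ a → ⟪ ν , a · ν ⟫Q ≡ a * + 2
    ⟪ν,·ν⟫ {ν} nν a = trans (dot-·ʳ a (ι ν) ν) (cong (a *_) nν)

  ·-cancelʳ-norm2 : ∀ {ν} → Norm2 ν → ∀ a b → a · ν ≡ b · ν → a ≡ b
  ·-cancelʳ-norm2 {ν} nν a b eq =
    ℤ.*-cancelʳ-≡ a b (+ 2) (trans (sym (⟪ν,·ν⟫ nν a)) (trans (cong (dot (ι ν)) eq) (⟪ν,·ν⟫ nν b)))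

  ·ι-cancelʳ-norm2 : ∀ {ν} → Norm2 ν → ∀ a b → a · ι ν ≡ b · ι ν → a ≡ b
  ·ι-cancelʳ-norm2 {ν} nν a b eq =
    ℤ.*-cancelʳ-≡ a b (+ 2) (trans (sym (⟪·ιν,ν⟫ a)) (trans (cong (λ u → dot u ν) eq) (⟪·ιν,ν⟫ b)))
    where
      ⟪·ιν,ν⟫ : ∀ a → dot (a · ι ν) ν ≡ a * + 2
      ⟪·ιν,ν⟫ a = trans (dot-·ˡ a (ι ν) ν) (cong (a *_) nν)

  -- t = ⟨ν, ν′⟩ satisfies t ν′ = 2ν (compare s_ν ν = −ν with s_ν′ ν), hence t² = 4.
  reflF-determines-root : ∀ {ν ν′} → Norm2 ν → (∀ l → onQ (reflF ν) l ≡ onQ (reflF ν′) l) →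
    ν′ ≡ ν ⊎ ν′ ≡ -1ℤ · ν
  reflF-determines-root {ν} {ν′} nν same = from-sign (square≡4 t t*t≡4)
    where
      t : ℤ
      t = ⟪ ν , ν′ ⟫Q
      tν′≡2ν : t · ν′ ≡ (+ 2) · ν
      tν′≡2ν = -u≡u⊖v⇒v≡2u ν (t · ν′) (trans (sym (reflF-self ν nν)) (same ν))
      t*t≡4 : t * t ≡ + 4
      t*t≡4 = trans (sym (dot-·ʳ t (ι ν) ν′)) (trans (cong (dot (ι ν)) tν′≡2ν) (⟪ν,·ν⟫ nν (+ 2)))
      from-sign : t ≡ + 2 ⊎ t ≡ - + 2 → ν′ ≡ ν ⊎ ν′ ≡ -1ℤ · ν
      from-sign (inj₁ t≡2) = inj₁ (·-cancelˡ (+ 2) ν′ ν (trans (cong (_· ν′) (sym t≡2)) tν′≡2ν))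
      from-sign (inj₂ t≡-2) = inj₂ (·-cancelˡ (- + 2) ν′ (-1ℤ · ν)
        (trans (cong (_· ν′) (sym t≡-2)) (trans tν′≡2ν (sym (·-assoc (- + 2) -1ℤ ν)))))

  reflF-neg-onQ : ∀ ν l → onQ (reflF (-1ℤ · ν)) l ≡ onQ (reflF ν) l
  reflF-neg-onQ ν l = cong (l ⊖_) (begin
    dot (ι l) (-1ℤ · ν) · (-1ℤ · ν)    ≡⟨ cong (_· (-1ℤ · ν)) (dot-·ʳ -1ℤ (ι l) ν) ⟩
    (-1ℤ * dot (ι l) ν) · (-1ℤ · ν)    ≡⟨ ·-assoc (-1ℤ * dot (ι l) ν) -1ℤ ν ⟩
    ((-1ℤ * dot (ι l) ν) * -1ℤ) · ν    ≡⟨ cong (_· ν) (lemma (dot (ι l) ν)) ⟩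
    dot (ι l) ν · ν                    ∎)
    where
      open ≡-Reasoning
      lemma : ∀ s → (- + 1 * s) * - + 1 ≡ s
      lemma = solve-∀

  reflF-neg-onP : ∀ ν μ → onP (reflF (-1ℤ · ν)) μ ≡ onP (reflF ν) μ
  reflF-neg-onP ν μ = cong (μ ⊖_) (begin
    dot μ (-1ℤ · ν) · ι (-1ℤ · ν)      ≡⟨ cong₂ _·_ (dot-·ʳ -1ℤ μ ν) (ι-· -1ℤ ν) ⟩
    (-1ℤ * dot μ ν) · (-1ℤ · ι ν)      ≡⟨ ·-assoc (-1ℤ * dot μ ν) -1ℤ (ι ν) ⟩
    ((-1ℤ * dot μ ν) * -1ℤ) · ι ν      ≡⟨ cong (_· ι ν) (lemma (dot μ ν)) ⟩
    dot μ ν · ι ν                      ∎)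
    where
      open ≡-Reasoning
      lemma : ∀ s → (- + 1 * s) * - + 1 ≡ s
      lemma = solve-∀

  actX-cong : ∀ {τ τ′ f f′} → τ ≡ τ′ → (∀ μ → onP f μ ≡ onP f′ μ) → ∀ ζ → actX (Y τ ⋆ f) ζ ≡ actX (Y τ′ ⋆ f′) ζ
  actX-cong refl eqP (mkX μ m l) rewrite eqP μ = refl

  actX-sAff-negA : ∀ γ ζ → actX (sAff (negA γ)) ζ ≡ actX (sAff γ) ζ
  actX-sAff-negA (ν +δ k) = actX-cong {f = reflF (-1ℤ · ν)} {f′ = reflF ν} translation (reflF-neg-onP ν)
    where
      translation : (- - k) · (-1ℤ · ν) ≡ (- k) · ν
      translation = trans (·-assoc (- - k) -1ℤ ν) (cong (_· ν) (lemma k))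
        where lemma : ∀ k → (- - k) * - + 1 ≡ - k
              lemma = solve-∀

  finW-cancelʳ-onQ : ∀ {f g h} → IsFinW f → (∀ l → onQ g (onQ f l) ≡ onQ h (onQ f l)) → ∀ l → onQ g l ≡ onQ h l
  finW-cancelʳ-onQ {f} {g} {h} isf eq l =
    trans (cong (onQ g) (sym (finW-inverseʳ isf l))) (trans (eq (onQinv f l)) (cong (onQ h) (finW-inverseʳ isf l)))

  sD-determines-root : ∀ {ν} → Norm2 ν → ∀ k j ζ w → IsWaff w → ∀ α′ →
    sD ((ν +δ k) +π j) (X^ ζ ⋆ w) ≈W sD α′ (X^ ζ ⋆ w) →
    α′ ≡ (ν +δ k) +π j ⊎ α′ ≡ negA (ν +δ k) +π (- j)
  sD-determines-root {ν} nν k j ζ w isw ((ν′ +δ k′) +π j′) (wt-eq , tr-eq , _ , onQ-eq , _)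
    with reflF-determines-root nν (finW-cancelʳ-onQ {g = reflF ν} {h = reflF ν′} isw onQ-eq)
  ... | inj₁ refl with ℤ.neg-injective (·-cancelʳ-norm2 nν (- k) (- k′) (⊕-cancelʳ _ _ _ tr-eq))
  ...   | refl = inj₁ (cong ((ν +δ k) +π_)
                   (sym (ℤ.neg-injective (·ι-cancelʳ-norm2 nν (- j) (- j′) (⊕-cancelʳ _ _ _ (cong fin wt-eq))))))
  sD-determines-root {ν} nν k j ζ w isw (((_ +δ k′) +π j′)) (wt-eq , tr-eq , _ , _ , _)
      | inj₂ refl with opposite-k
    where
      flip : ∀ a → (- a) * - + 1 ≡ a
      flip = solve-∀
      opposite-k : - k ≡ k′
      opposite-k = trans (·-cancelʳ-norm2 nν (- k) ((- k′) * -1ℤ)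
                           (trans (⊕-cancelʳ _ _ _ (trans tr-eq (cong (_⊕_ ((- k′) · (-1ℤ · ν))) (reflF-neg-onQ ν (tr w)))))
                                  (·-assoc (- k′) -1ℤ ν)))
                         (flip k′)
  ... | refl = inj₂ (cong (negA (ν +δ k) +π_) (sym opposite-j))
    where
      flip : ∀ a → (- a) * - + 1 ≡ a
      flip = solve-∀
      same-fin : fin (actX (sAff (negA (ν +δ k))) ζ) ≡ fin (actX (sAff (ν +δ k)) ζ)
      same-fin = cong fin (actX-sAff-negA (ν +δ k) ζ)
      opposite-j : - j ≡ j′
      opposite-j = trans (·ι-cancelʳ-norm2 nν (- j) ((- j′) * -1ℤ)
                           (trans (⊕-cancelʳ _ _ _ (trans (cong fin wt-eq) (cong (_⊕_ ((- j′) · ι (-1ℤ · ν))) same-fin)))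
                                  (trans (cong ((- j′) ·_) (ι-· -1ℤ ν)) (·-assoc (- j′) -1ℤ (ι ν)))))
                         (flip j′)

  invR-negA : ∀ w → IsWaff w → ∀ ρ → invR w (negA ρ) ≡ negA (invR w ρ)
  invR-negA (Y τ ⋆ f) isf (μ +δ k) = cong₂ _+δ_ (finW-onQinv-· isf -1ℤ μ)
    (trans (cong (_+_ (- k)) (dot-·ʳ -1ℤ (ι τ) μ)) (lemma k (dot (ι τ) μ)))
    where lemma : ∀ k d → - k + - + 1 * d ≡ - (k + d)
          lemma = solve-∀

  invR-norm2 : ∀ w → IsWaff w → ∀ ρ → Norm2 (rt ρ) → Norm2 (rt (invR w ρ))
  invR-norm2 (Y τ ⋆ f) isf (μ +δ k) nμ = trans (finW-onQinv-pairingQ isf μ μ) nμ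

module DihedralChains (R : SimplyLacedCartan) where
  open RootData R
  open RootDatum R
  open AffineAction R
  open Positivity R
  open ReflectionUniqueness R

  module _ {ν : Q} (rootν : IsRoot ν) (k : ℤ) (ζ : X) (w : Waff) (isw : IsWaff w)
           (c : ℤ) (⟪ζ,γ⟫≡-c : ⟪ ζ , ν +δ k ⟫X ≡ - c) where

    private
      nν : Norm2 ν
      nν = root-norm2 rootν
    open Dihedral ν k nν

    x : Wel
    x = X^ ζ ⋆ w

    private
      h h′ : AffRoot
      h = invR w γ
      h′ = invR w (negA γ)

      ⟪ζ,-γ⟫≡c : ⟪ ζ , negA γ ⟫X ≡ c
      ⟪ζ,-γ⟫≡c = trans (pairing-negA ζ γ) (trans (cong -_ ⟪ζ,γ⟫≡-c) (ℤ.neg-involutive c))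

      lev-sD : ∀ a ξ → lev (wt (sD (γ +π a) (X^ ξ ⋆ w))) ≡ lev ξ
      lev-sD a ξ = trans (cong (_+ lev ξ) (ℤ.*-zeroʳ (- a))) (ℤ.+-identityˡ (lev ξ))

      ≈W-refl : ∀ z → z ≈W z
      ≈W-refl z = refl , refl , (λ _ → refl) , (λ _ → refl) , (λ _ → refl)

    HasIntermediate : ℤ → Set
    HasIntermediate j = Σ Wel (λ z → (sD (γ +π j) x <B z) × (z <B x))

    -- The hypotheses are the π-coefficients of x⁻¹(γ + a₁π), z₁⁻¹(γ + a₂π) and z₂⁻¹(γ + a₃π).
    three-step-chain : ∀ a₁ a₂ a₃ → IsW x → + 0 < levW x → + 0 < a₁ → + 0 < a₂ → + 0 < a₃
      → DNeg (h +π (a₁ - c))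
      → DNeg (h′ +π ((a₂ - + 2 * a₁) + c))
      → DNeg (h +π (((a₃ - + 2 * a₂) + + 2 * a₁) - c))
      → HasIntermediate (a₁ - a₂ + a₃)
    three-step-chain a₁ a₂ a₃ isWx 0<lev 0<a₁ 0<a₂ 0<a₃ neg₁ neg₂ neg₃ = z₂ , [ step₃ ] , step₂ ∷ [ step₁ ]
      where
        z₁ : Wel
        z₁ = sD (γ +π a₁) x
        z₂ : Wel
        z₂ = sD (γ +π a₂) z₁
        0<lev₁ : + 0 < levW z₁
        0<lev₁ = subst (+ 0 <_) (sym (lev-sD a₁ ζ)) 0<lev
        0<lev₂ : + 0 < levW z₂
        0<lev₂ = subst (+ 0 <_) (sym (lev-sD a₂ (wt z₁))) 0<lev₁
        isγ : IsFinW (reflF ν)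
        isγ = reflF-finW rootν
        step₁ : BStep z₁ x
        step₁ = isWx , 0<lev , γ +π a₁ , rootν , DPos-of-positive γ 0<a₁
              , subst (λ q → DNeg (h +π (a₁ + q))) (sym ⟪ζ,γ⟫≡-c) neg₁ , ≈W-refl z₁
        step₂ : BStep z₂ z₁
        step₂ = (inj₂ 0<lev₁ , finW-∘ isγ isw) , 0<lev₁ , γ +π a₂ , rootν , DPos-of-positive γ 0<a₂
              , subst DNeg (sym (trans (invW-sD-γ a₁ ζ w a₂) (cong (λ q → h′ +π ((a₂ - + 2 * a₁) + q)) ⟪ζ,-γ⟫≡c))) neg₂
              , ≈W-refl z₂
        step₃ : BStep (sD (γ +π (a₁ - a₂ + a₃)) x) z₂
        step₃ = (inj₂ 0<lev₂ , finW-∘ isγ (finW-∘ isγ isw)) , 0<lev₂ , γ +π a₃ , rootν , DPos-of-positive γ 0<a₃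
              , subst DNeg (sym (trans (invW-sD-γ a₂ (wt z₁) (aff z₁) a₃)
                                (trans (invW-sD-negA-γ a₁ ζ w (a₃ - + 2 * a₂))
                                       (cong (λ q → h +π (((a₃ - + 2 * a₂) + + 2 * a₁) + q)) ⟪ζ,γ⟫≡-c)))) neg₃
              , sD-three-reflections a₁ a₂ a₃ ζ w

    private
      module Gaps (j : ℤ) (1<j : + 1 < j) (j<c-1 : j < c - + 1) where
        d d′ : ℤ
        d = j - + 2
        d′ = (c - + 2) - j
        0≤d : + 0 ≤ d
        0≤d = ℤ.i≤j⇒0≤j-i (ℤ.i<j⇒suc[i]≤j 1<j)
        0≤d′ : + 0 ≤ d′
        0≤d′ = subst (+ 0 ≤_) (gap c j) (ℤ.i≤j⇒0≤j-i (ℤ.i<j⇒suc[i]≤j j<c-1))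
          where gap : ∀ c j → (c - + 1) - (+ 1 + j) ≡ (c - + 2) - j
                gap = solve-∀
        0≤d′+d+_ : ∀ n → + 0 ≤ (d′ + d) + + n
        0≤d′+d+ n = ℤ.+-mono-≤ (ℤ.+-mono-≤ 0≤d′ 0≤d) (0≤+ n)
        0<j-1 : + 0 < j - + 1
        0<j-1 = positive-by d 0≤d (lemma j)
          where lemma : ∀ j → j - + 1 ≡ (j - + 2) + + 1
                lemma = solve-∀

      between-if-h≯0 : ∀ j → IsW x → + 0 < levW x → + 1 < j → j < c - + 1 → ¬ PosAff h → HasIntermediate j
      between-if-h≯0 j isWx 0<lev 1<j j<c-1 h≯0 = subst HasIntermediate (lemma c j)
        (three-step-chain c (c - + 1) (j - + 1) isWx 0<lev
           (positive-by ((d′ + d) + + 3) (0≤d′+d+ 3) (lemma₁ c j))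
           (positive-by ((d′ + d) + + 2) (0≤d′+d+ 2) (lemma₂ c j))
           0<j-1
           (DNeg-of-zero h (ℤ.+-inverseʳ c) h≯0)
           (DNeg-of-negative h′ (negative-by (+ 0) (0≤+ 0) (lemma₃ c)))
           (DNeg-of-negative h (negative-by d′ 0≤d′ (lemma₄ c j))))
        where
          open Gaps j 1<j j<c-1
          lemma : ∀ c j → c - (c - + 1) + (j - + 1) ≡ j
          lemma = solve-∀
          lemma₁ : ∀ c j → c ≡ ((((c - + 2) - j) + (j - + 2)) + + 3) + + 1
          lemma₁ = solve-∀
          lemma₂ : ∀ c j → c - + 1 ≡ ((((c - + 2) - j) + (j - + 2)) + + 2) + + 1
          lemma₂ = solve-∀
          lemma₃ : ∀ c → ((c - + 1) - + 2 * c) + c ≡ - + 0 - + 1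
          lemma₃ = solve-∀
          lemma₄ : ∀ c j → (((j - + 1) - + 2 * (c - + 1)) + + 2 * c) - c ≡ - ((c - + 2) - j) - + 1
          lemma₄ = solve-∀

      between-if-h′≯0 : ∀ j → IsW x → + 0 < levW x → + 1 < j → j < c - + 1 → ¬ PosAff h′ → HasIntermediate j
      between-if-h′≯0 j isWx 0<lev 1<j j<c-1 h′≯0 = subst HasIntermediate (lemma c j)
        (three-step-chain (c - + 1) (c - + 2) (j - + 1) isWx 0<lev
           (positive-by ((d′ + d) + + 2) (0≤d′+d+ 2) (lemma₁ c j))
           (positive-by ((d′ + d) + + 1) (0≤d′+d+ 1) (lemma₂ c j))
           0<j-1
           (DNeg-of-negative h (negative-by (+ 0) (0≤+ 0) (lemma₃ c)))
           (DNeg-of-zero h′ (lemma₄ c) h′≯0)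
           (DNeg-of-negative h (negative-by d′ 0≤d′ (lemma₅ c j))))
        where
          open Gaps j 1<j j<c-1
          lemma : ∀ c j → (c - + 1) - (c - + 2) + (j - + 1) ≡ j
          lemma = solve-∀
          lemma₁ : ∀ c j → c - + 1 ≡ ((((c - + 2) - j) + (j - + 2)) + + 2) + + 1
          lemma₁ = solve-∀
          lemma₂ : ∀ c j → c - + 2 ≡ ((((c - + 2) - j) + (j - + 2)) + + 1) + + 1
          lemma₂ = solve-∀
          lemma₃ : ∀ c → (c - + 1) - c ≡ - + 0 - + 1
          lemma₃ = solve-∀
          lemma₄ : ∀ c → ((c - + 2) - + 2 * (c - + 1)) + c ≡ + 0
          lemma₄ = solve-∀
          lemma₅ : ∀ c j → (((j - + 1) - + 2 * (c - + 2)) + + 2 * (c - + 1)) - c ≡ - ((c - + 2) - j) - + 1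
          lemma₅ = solve-∀

    between-in-window : ∀ j → IsW x → + 0 < levW x → + 1 < j → j < c - + 1 → HasIntermediate j
    between-in-window j isWx 0<lev 1<j j<c-1 with PosAff? h′
    ... | yes h′>0 = between-if-h≯0 j isWx 0<lev 1<j j<c-1
                       (λ h>0 → PosAff-opposite h (invR-norm2 w isw γ nν) h>0 (subst PosAff (invR-negA w isw γ) h′>0))
    ... | no h′≯0 = between-if-h′≯0 j isWx 0<lev 1<j j<c-1 h′≯0

    no-step-beyond : ∀ j → c < j → DPos (γ +π j) → ¬ BStep (sD (γ +π j) x) x
    no-step-beyond j c<j pos (_ , _ , α′ , _ , pos′ , neg′ , y≈) with sD-determines-root nν k j ζ w isw α′ y≈
    ... | inj₁ refl = neg′ (DPos-of-positive h (subst (λ q → + 0 < j + q) (sym ⟪ζ,γ⟫≡-c) 0<j-c))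
      where
        0<j-c : + 0 < j - c
        0<j-c = positive-by (j - (+ 1 + c)) (ℤ.i≤j⇒0≤j-i (ℤ.i<j⇒suc[i]≤j c<j)) (lemma j c)
          where lemma : ∀ j c → j - c ≡ (j - (+ 1 + c)) + + 1
                lemma = solve-∀
    ... | inj₂ refl = DPos-opposite γ nν pos pos′

module Lengths (R : SimplyLacedCartan) where
  open RootData R
  open RootDatum R

  length-bound-positive : ∀ θ w β M → Norm2 (rt β) → LengthLE θ w M → LengthLE θ (sAff β ∘A w) M → + 0 < M
  length-bound-positive θ w β M _ (_ ∷ _ , |ws|≤M , _) _ = ℤ.<-≤-trans (+<+ (ℕ.s≤s ℕ.z≤n)) |ws|≤M
  length-bound-positive θ w β M _ ([] , _ , _) (_ ∷ _ , |ws|≤M , _) = ℤ.<-≤-trans (+<+ (ℕ.s≤s ℕ.z≤n)) |ws|≤M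
  length-bound-positive θ w (ν +δ k) M nν ([] , _ , _ , _ , id≈w , _) ([] , _ , _ , _ , id≈sw , _) with 2≡-2
    where
      ν≡-ν : ν ≡ -1ℤ · ν
      ν≡-ν = trans (id≈sw ν) (trans (cong (onQ (reflF ν)) (sym (id≈w ν))) (reflF-self ν nν))
      2≡-2 : + 2 ≡ -1ℤ * + 2
      2≡-2 = trans (sym nν) (trans (cong (dot (ι ν)) ν≡-ν) (trans (dot-·ʳ -1ℤ (ι ν) ν) (cong (-1ℤ *_) nν)))
  ... | ()

mainTheorem11 : (R : SimplyLacedCartan) → let open RootData R in
    (θ : Q) → IsHighestRoot θ →
    (ζ : X) → Dominant θ ζ →
    (v w : Waff) → IsWaff v → IsWaff w →
    (α̃ : AffRoot) → IsAffRoot α̃ → (j : ℤ) →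
    DPos (negA (actR v α̃) +π j) →
    (M : ℤ) → LengthLE θ w M → LengthLE θ (sAff (actR v α̃) ∘A w) M →
    (∀ (i : Fin (suc n)) → + 2 * (M + + 1) ≤ ⟪ ζ , affSimple θ i ⟫X) →
    Cocover (sD (negA (actR v α̃) +π j) (X^ actX v ζ ⋆ w)) (X^ actX v ζ ⋆ w) →
    ((+ 0 ≤ j) × (j ≤ M)) ⊎ ((⟪ ζ , α̃ ⟫X - M ≤ j) × (j ≤ ⟪ ζ , α̃ ⟫X))
mainTheorem11 R θ _ ζ _ v w isv isw α̃ isα̃ j pos M |w|≤M |sw|≤M _ (y<x , nothing-between) =
  decide (j ≤? M) (c - M ≤? j) (j ≤? c)
  where
    open RootData R
    open RootDatum R
    open AffineAction R
    open Positivity R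
    open DihedralChains R
    open Lengths R
    c : ℤ
    c = ⟪ ζ , α̃ ⟫X
    rootγ : IsRoot (rt (negA (actR v α̃)))
    rootγ = root-neg (finW-root isv isα̃)
    ⟪vζ,γ⟫≡-c : ⟪ actX v ζ , negA (actR v α̃) ⟫X ≡ - c
    ⟪vζ,γ⟫≡-c = trans (pairing-negA (actX v ζ) (actR v α̃)) (cong -_ (actX-actR-pairing v (finW-isIsometry isv) ζ α̃))
    step : BStep (sD (negA (actR v α̃) +π j) (X^ actX v ζ ⋆ w)) (X^ actX v ζ ⋆ w)
    step = unsplittable⇒step y<x nothing-between
    1≤M : + 1 ≤ M
    1≤M = ℤ.i<j⇒suc[i]≤j (length-bound-positive θ w (actR v α̃) M (root-norm2 (finW-root isv isα̃)) |w|≤M |sw|≤M)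
    decide : Dec (j ≤ M) → Dec (c - M ≤ j) → Dec (j ≤ c) → ((+ 0 ≤ j) × (j ≤ M)) ⊎ ((c - M ≤ j) × (j ≤ c))
    decide (yes j≤M) _ _ = inj₁ (DPos⇒0≤coefficient (negA (actR v α̃)) pos , j≤M)
    decide (no _) (yes c-M≤j) (yes j≤c) = inj₂ (c-M≤j , j≤c)
    decide (no _) (yes _) (no j≰c) =
      ⊥-elim (no-step-beyond rootγ (r (negA (actR v α̃))) (actX v ζ) w isw c ⟪vζ,γ⟫≡-c j (ℤ.≰⇒> j≰c) pos step)
    decide (no j≰M) (no c-M≰j) _ =
      ⊥-elim (nothing-between (between-in-window rootγ (r (negA (actR v α̃))) (actX v ζ) w isw c ⟪vζ,γ⟫≡-c j
                (proj₁ step) (proj₁ (proj₂ step)) (ℤ.≤-<-trans 1≤M (ℤ.≰⇒> j≰M))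
                (ℤ.<-≤-trans (ℤ.≰⇒> c-M≰j) (ℤ.+-monoʳ-≤ c (ℤ.neg-mono-≤ 1≤M)))))
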